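{- Let $n\ge3$, $d\ge0$, $G\in\mathcal{K}_{n,d}$, and let $\{C_0,C_1,\dots,C_k\}$ be a stretched-clique decomposition of $G$. Then $\sum_{v\in C_0}x_v\le d-k+1$ is a facet-inducing inequality for $\mathrm{STAB}(G)$.
   Context: $\mathrm{STAB}(G)$ is the convex hull of the incidence vectors of stable sets of $G$ (a full-dimensional polytope in $\mathbb{R}^{V(G)}$). Stretched cliques: stretching a vertex $v$ with sets $A_1,\dots,A_m\subseteq\Gamma(v)$ (possibly empty, union $\Gamma(v)$) replaces $v$ by new vertices $v_0,\dots,v_m$, joining each $v_j$ ($j\in[m]$) to $v_0$ and to all of $A_j$; $m=2$ gives a 2-stretching. $\mathcal{K}_{n,d}$ is the set of graphs obtained from $K_n$ (vertex set $[n]$) by 2-stretching $d$ of its original vertices, each at most once. For $G\in\mathcal{K}_{n,d}$, $D(G)$ is the set of stretched original vertices; for $i\in D(G)$, $i_0$ is a hub and $i_1,i_2$ are wings. The vertices associated with $i$ are $i_0,i_1,i_2$ if $i\in D(G)$ and $i$ otherwise. For a wing $i_\ell$, $\tilde\Gamma_G(i_\ell)$ is the set of $j\in[n]\setminus\{i\}$ such that $i_\ell$ is adjacent to a vertex associated with $j$; $\tilde{\mathcal{K}}_{n,d}$ is the set of $G\in\mathcal{K}_{n,d}$ with $\tilde\Gamma_G(i_\ell)\subsetneq[n]\setminus\{i\}$ for all $i\in D(G)$, $\ell\in\{1,2\}$. A stretched-clique decomposition of $G\in\mathcal{K}_{n,d}$ is a partition $\{C_0,C_1,\dots,C_k\}$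 of $V(G)$ such that $C_0$ induces a graph in $\tilde{\mathcal{K}}_{n,d-k}$ and each $C_1,\dots,C_k$ is an edge of $G$ consisting of a hub vertex and a wing vertex. -}

module Defs where

open import Data.Bool using (Bool; true; false; if_then_else_)
open import Data.Nat using (_+_; _∸_)
open import Data.Nat using (ℕ; zero; suc)
open import Data.Fin using (Fin; zero; suc)
open import Data.Fin.Properties using (_≟_)
open import Data.Product using (Σ; ∃; ∃-syntax; _×_; _,_; proj₁)
open import Data.Sum using (_⊎_)
open import Data.Integer as ℤ using (ℤ; +_)
open import Data.Rational as ℚ using (ℚ; 0ℚ; 1ℚ)
open import Relation.Nullary using (¬_; yes; no; does)
open import Relation.Binary.PropositionalEquality using (_≡_)

sumFin : {N : ℕ} → (Fin N → ℚ) → ℚ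
sumFin {zero}  f = 0ℚ
sumFin {suc N} f = f zero ℚ.+ sumFin (λ i → f (suc i))

countTrue : {n : ℕ} → (Fin n → Bool) → ℕ
countTrue {zero}  D = zero
countTrue {suc n} D = (if D zero then 1 else 0) + countTrue (λ i → D (suc i))

Stable : {N : ℕ} → (Fin N → Fin N → Bool) → (Fin N → Bool) → Set
Stable E s = ∀ u v → s u ≡ true → s v ≡ true → E u v ≡ false

incidence : {N : ℕ} → (Fin N → Bool) → Fin N → ℚ
incidence s v = if s v then 1ℚ else 0ℚ

dot : {N : ℕ} → (Fin N → ℚ) → (Fin N → ℚ) → ℚ
dot a x = sumFin (λ v → a v ℚ.* x v)

AffinelyIndependent : {M N : ℕ} → (Fin M → Fin N → ℚ) → Set
AffinelyIndependent {M} {N} p =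
  ∀ (λs : Fin M → ℚ) → sumFin λs ≡ 0ℚ →
  (∀ v → sumFin (λ t → λs t ℚ.* p t v) ≡ 0ℚ) → ∀ t → λs t ≡ 0ℚ

-- a·x ≤ b is valid for STAB(G)  (STAB(G) is the convex hull of the
-- incidence vectors of stable sets, so validity on these vectors)
ValidForSTAB : {N : ℕ} → (Fin N → Fin N → Bool) → (Fin N → ℚ) → ℚ → Set
ValidForSTAB E a b = ∀ s → Stable E s → dot a (incidence s) ℚ.≤ b

-- a·x ≤ b is facet-inducing for STAB(G) (STAB(G) is full-dimensional in
-- ℚ^N): it is valid and the face it induces has dimension N-1, i.e. it
-- contains N affinely independent vertices of STAB(G).
FacetInducing : {N : ℕ} → (Fin N → Fin N → Bool) → (Fin N → ℚ) → ℚ → Set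
FacetInducing {N} E a b =
  ValidForSTAB E a b ×
  Σ (Fin N → Fin N → Bool) λ ss →
    (∀ t → Stable E (ss t)) ×
    (∀ t → dot a (incidence (ss t)) ≡ b) ×
    AffinelyIndependent (λ t → incidence (ss t))

-- Labels: (i , 0) is original vertex i (if unstretched) or hub i₀ (if
-- stretched); (i , 1), (i , 2) are the wings i₁, i₂ (only if stretched).

Lab : ℕ → Set
Lab n = Fin n × Fin 3

valid : {n : ℕ} → (Fin n → Bool) → Lab n → Bool
valid D (i , zero)  = true
valid D (i , suc _) = D i

Kadj : {n : ℕ} → Lab n → Lab n → Bool
Kadj (i , zero) (j , zero) = if does (i ≟ j) then false else true
Kadj (i , zero) (j , suc _) = false
Kadj (i , suc _) (j , _)    = false

innerAdj : Fin 3 → Fin 3 → Bool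
innerAdj zero    (suc _) = true
innerAdj (suc _) zero    = true
innerAdj _       _       = false

newAdj : {n : ℕ} → Fin 3 → (Lab n → Bool) → (Lab n → Bool) → Lab n → Bool
newAdj zero                A₁ A₂ u = false
newAdj (suc zero)          A₁ A₂ u = A₁ u
newAdj (suc (suc zero))    A₁ A₂ u = A₂ u

stretchAdj : {n : ℕ} → (Lab n → Lab n → Bool) → Fin n →
             (Lab n → Bool) → (Lab n → Bool) → Lab n → Lab n → Bool
stretchAdj adj i A₁ A₂ (j , a) (k , b) with j ≟ i | k ≟ i
... | yes _ | yes _ = innerAdj a b
... | yes _ | no  _ = newAdj a A₁ A₂ (k , b)
... | no  _ | yes _ = newAdj b A₁ A₂ (j , a)
... | no  _ | no  _ = adj (j , a) (k , b)

insertD : {n : ℕ} → (Fin n → Bool) → Fin n → Fin n → Bool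
insertD D i j = if does (j ≟ i) then true else D j

data Built (n : ℕ) : (Fin n → Bool) → (Lab n → Lab n → Bool) → Set where
  base    : Built n (λ _ → false) Kadj
  stretch : ∀ {D adj} → Built n D adj →
            (i : Fin n) → D i ≡ false →
            (A₁ A₂ : Lab n → Bool) →
            (∀ u → A₁ u ≡ true → adj (i , zero) u ≡ true) →
            (∀ u → A₂ u ≡ true → adj (i , zero) u ≡ true) →
            (∀ u → adj (i , zero) u ≡ true → A₁ u ≡ true ⊎ A₂ u ≡ true) →
            Built n (insertD D i) (stretchAdj adj i A₁ A₂)

-- A graph (V , E) is in 𝒦_{n,d}, together with the structure witnessing
-- it: a labelled construction and an isomorphism V ≅ valid labels.
record InK (V : Set) (E : V → V → Bool) (n d : ℕ) : Set where
  field
    D       : Fin n → Bool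
    adj     : Lab n → Lab n → Bool
    built   : Built n D adj
    countD  : countTrue D ≡ d
    lab     : V → Lab n
    labValid : ∀ v → valid D (lab v) ≡ true
    labInj  : ∀ u v → lab u ≡ lab v → u ≡ v
    labSurj : ∀ l → valid D l ≡ true → ∃[ v ] lab v ≡ l
    labAdj  : ∀ u v → E u v ≡ adj (lab u) (lab v)

  IsHub : V → Set
  IsHub u = Σ (Fin n) λ i → D i ≡ true × lab u ≡ (i , zero)

  -- u is a wing vertex i₁ or i₂ (labels (i,1),(i,2) are only used for i ∈ D(G))
  IsWing : V → Set
  IsWing u = Σ (Fin n) λ i → Σ (Fin 2) λ ℓ → lab u ≡ (i , suc ℓ)

  -- 𝒦̃ condition: for every wing i_ℓ, Γ̃(i_ℓ) ⊊ [n] ∖ {i}, i.e. some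
  -- j ≠ i has no associated vertex adjacent to i_ℓ.
  TildeCondition : Set
  TildeCondition = ∀ w (i : Fin n) (ℓ : Fin 2) → lab w ≡ (i , suc ℓ) →
    ∃[ j ] (¬ j ≡ i × (∀ v → proj₁ (lab v) ≡ j → E w v ≡ false))

record InKTilde (V : Set) (E : V → V → Bool) (n d : ℕ) : Set where
  field
    struct : InK V E n d
    tilde  : InK.TildeCondition struct

-- Stretched-clique decomposition {C₀ , C₁ , … , C_k} of G ∈ 𝒦_{n,d},
-- given by part : V(G) → Fin (k+1), C_j = part⁻¹(j).

record SCDecomposition {N n d : ℕ} {E : Fin N → Fin N → Bool}
       (G : InK (Fin N) E n d) (k : ℕ) (part : Fin N → Fin (suc k)) : Set where
  open InK G
  field
    C₀-tilde : InKTilde (Σ (Fin N) λ v → part v ≡ zero)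
                        (λ u w → E (proj₁ u) (proj₁ w)) n (d ∸ k)
    C-edge : ∀ (j : Fin k) → Σ (Fin N) λ u → Σ (Fin N) λ w →
      part u ≡ suc j × part w ≡ suc j ×
      (∀ v → part v ≡ suc j → v ≡ u ⊎ v ≡ w) ×
      E u w ≡ true × IsHub u × IsWing w

C₀-coeffs : {N k : ℕ} → (Fin N → Fin (suc k)) → Fin N → ℚ
C₀-coeffs part v with part v
... | zero  = 1ℚ
... | suc _ = 0ℚ

rhs : ℕ → ℕ → ℚ
rhs d k = ((+ d) ℤ.- (+ k) ℤ.+ (+ 1)) ℚ./ 1

module Submission where

-- C₀ induces a graph H ∈ 𝒦̃_{n,d-k}, i.e. Kₙ after d-k stretchings. Induction along the
-- stretchings shows (a) a stable set of H has at most d-k+1 vertices (undoing a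
-- stretching loses at most one of them), and (b) H has |V(H)| affinely independent
-- stable sets of that size: stretching i turns a set containing i into the set with both
-- new wings instead, and any other set into the set with the new hub added; a new wing
-- gets the set of itself, all hubs except that of a group j it misses entirely, and the
-- top of group j (j itself, or its two wings). The 𝒦̃ condition provides j.
-- By (a) the inequality is valid. For t outside C₀, the set of G made of all hubs but
-- one group's plus that group's top, chosen to contain t, has d+1 vertices and meets
-- every hub-wing edge C_j once, so its trace on C₀ ∪ {t} is tight. These sets have t as
-- their only vertex outside C₀, so an affine dependence vanishes outside C₀, and then
-- on C₀ by (b).

open import Defs
open import Data.Nat using (ℕ; _≤_)
open import Data.Fin using (Fin)
open import Data.Bool using (Bool)

open import Algebra.Bundles using (CommutativeMonoid)
import Axiom.UniquenessOfIdentityProofs as UIP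
open import Data.Bool using (true; false; if_then_else_; not; _∧_; _∨_)
open import Data.Bool.Properties using (if-float; ∧-conicalˡ; ∧-conicalʳ; ¬-not)
open import Data.Empty using (⊥; ⊥-elim)
open import Data.Fin using (zero; suc; punchIn)
open import Data.Fin.Properties using (_≟_; punchInᵢ≢i; suc-injective)
open import Data.Integer as ℤ using (+_)
import Data.Integer.Properties as ℤ
open import Data.Nat as ℕ using (zero; suc; z≤n; s≤s; _∸_)
import Data.Nat.Coprimality as Coprime
import Data.Nat.Properties as ℕ
open import Data.Product using (Σ; ∃-syntax; _×_; _,_; proj₁; proj₂)
open import Data.Product.Properties using (≡-dec)
open import Data.Rational as ℚ using (ℚ; 0ℚ; 1ℚ; mkℚ)
import Data.Rational.Properties as ℚ
open import Data.Rational.Solver using (module +-*-Solver)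
open import Data.Sum using (_⊎_; inj₁; inj₂; [_,_]′)
open import Data.Unit using (⊤)
open import Function using (_∘′_)
open import Level using (0ℓ)
open import Relation.Binary.PropositionalEquality
  using (_≡_; _≢_; refl; sym; trans; cong; cong₂; subst; subst₂; module ≡-Reasoning)
open import Relation.Nullary using (yes; no; does; Dec)
open import Relation.Nullary.Decidable using (dec-true; dec-false)

toℚ : ℕ → ℚ
toℚ m = + m ℚ./ 1

toℚ≡mkℚ : ∀ m → toℚ m ≡ mkℚ (+ m) 0 (Coprime.sym (Coprime.1-coprimeTo m))
toℚ≡mkℚ m = ℚ.normalize-coprime (Coprime.sym (Coprime.1-coprimeTo m))

toℚ-+ : ∀ m n → toℚ (m ℕ.+ n) ≡ toℚ m ℚ.+ toℚ n
toℚ-+ m n rewrite toℚ≡mkℚ m | toℚ≡mkℚ n =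
  cong (ℚ._/ 1) (sym (cong₂ ℤ._+_ (ℤ.*-identityʳ (+ m)) (ℤ.*-identityʳ (+ n))))

toℚ-mono-≤ : ∀ {m n} → m ≤ n → toℚ m ℚ.≤ toℚ n
toℚ-mono-≤ {m} {n} m≤n rewrite toℚ≡mkℚ m | toℚ≡mkℚ n =
  ℚ.*≤* (subst₂ ℤ._≤_ (sym (ℤ.*-identityʳ (+ m))) (sym (ℤ.*-identityʳ (+ n))) (ℤ.+≤+ m≤n))

rhs≡toℚ : ∀ {d k} → k ≤ d → rhs d k ≡ toℚ (suc (d ∸ k))
rhs≡toℚ {d} {k} k≤d = begin
  rhs d k            ≡⟨ cong (λ z → (z ℤ.+ + 1) ℚ./ 1) (trans (ℤ.m-n≡m⊖n d k) (ℤ.⊖-≥ k≤d)) ⟩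
  toℚ (d ∸ k ℕ.+ 1)  ≡⟨ cong toℚ (ℕ.+-comm (d ∸ k) 1) ⟩
  toℚ (suc (d ∸ k))  ∎
  where open ≡-Reasoning

bit : Bool → ℕ
bit b = if b then 1 else 0

indicator : Bool → ℚ
indicator b = if b then 1ℚ else 0ℚ

indicator≡toℚ-bit : ∀ b → indicator b ≡ toℚ (bit b)
indicator≡toℚ-bit true  = refl
indicator≡toℚ-bit false = refl

sumFin-incidence : ∀ {N} (s : Fin N → Bool) → sumFin (incidence s) ≡ toℚ (countTrue s)
sumFin-incidence {zero} s = refl
sumFin-incidence {suc N} s = begin
  incidence s zero ℚ.+ sumFin (incidence (s ∘′ suc))
    ≡⟨ cong₂ ℚ._+_ (indicator≡toℚ-bit (s zero)) (sumFin-incidence (s ∘′ suc)) ⟩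
  toℚ (bit (s zero)) ℚ.+ toℚ (countTrue (s ∘′ suc))
    ≡⟨ toℚ-+ (bit (s zero)) (countTrue (s ∘′ suc)) ⟨
  toℚ (countTrue s) ∎
  where open ≡-Reasoning

_[_≔_] : ∀ {n} {A : Set} → (Lab n → A) → Fin n → (Fin 3 → A) → Lab n → A
(f [ i ≔ g ]) (k , b) = if does (k ≟ i) then g b else f (k , b)

module _ {n : ℕ} {A : Set} {f : Lab n → A} {i : Fin n} {g : Fin 3 → A} where

  [≔]-≡ : ∀ b → (f [ i ≔ g ]) (i , b) ≡ g b
  [≔]-≡ b rewrite dec-true (i ≟ i) refl = refl

  [≔]-≢ : ∀ {k} b → k ≢ i → (f [ i ≔ g ]) (k , b) ≡ f (k , b)
  [≔]-≢ {k} b k≢i rewrite dec-false (k ≟ i) k≢i = refl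

[≔]-map : ∀ {n} {A B : Set} (h : A → B) (f : Lab n → A) i g l → h ((f [ i ≔ g ]) l) ≡ ((h ∘′ f) [ i ≔ h ∘′ g ]) l
[≔]-map h f i g (k , b) = if-float h (does (k ≟ i))

module FinSum (M : CommutativeMonoid 0ℓ 0ℓ) where

  open CommutativeMonoid M
    using (Carrier; _≈_; setoid; ∙-congˡ; ∙-congʳ; identityʳ; reflexive; comm)
    renaming (_∙_ to _+_; ε to 0#; trans to ≈-trans; sym to ≈-sym; refl to ≈-refl)
  open import Algebra.Properties.CommutativeMonoid.Sum M public
    using (sum; sum-remove; ∑-comm; ∑-distrib-+; sum-cong-≋; sum-replicate-zero)
  open import Algebra.Solver.CommutativeMonoid M using (solve; _⊕_; _⊜_)
  open import Relation.Binary.Reasoning.Setoid setoid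

  sum-zero : ∀ {m} {f : Fin m → Carrier} → (∀ i → f i ≈ 0#) → sum f ≈ 0#
  sum-zero {m} f≈0 = ≈-trans (sum-cong-≋ f≈0) (sum-replicate-zero m)

  sum-single : ∀ {m} {f : Fin m → Carrier} i → (∀ j → j ≢ i → f j ≈ 0#) → sum f ≈ f i
  sum-single {suc m} {f} i f≈0 = begin
    sum f                       ≈⟨ sum-remove f ⟩
    f i + sum (f ∘′ punchIn i)  ≈⟨ ∙-congˡ (sum-zero (λ j → f≈0 (punchIn i j) (punchInᵢ≢i i j))) ⟩
    f i + 0#                    ≈⟨ identityʳ (f i) ⟩
    f i                         ∎

  sum-exchange : ∀ {m} {f g : Fin m → Carrier} i → (∀ j → j ≢ i → f j ≈ g j) →
                 sum f + g i ≈ sum g + f i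
  sum-exchange {suc m} {f} {g} i f≈g = begin
    sum f + g i
      ≈⟨ ∙-congʳ (sum-remove f) ⟩
    (f i + sum (f ∘′ punchIn i)) + g i
      ≈⟨ ∙-congʳ (∙-congˡ (sum-cong-≋ (λ j → f≈g (punchIn i j) (punchInᵢ≢i i j)))) ⟩
    (f i + sum (g ∘′ punchIn i)) + g i
      ≈⟨ solve 3 (λ x y z → (x ⊕ y) ⊕ z ⊜ (z ⊕ y) ⊕ x) ≈-refl (f i) (sum (g ∘′ punchIn i)) (g i) ⟩
    (g i + sum (g ∘′ punchIn i)) + f i
      ≈⟨ ∙-congʳ (≈-sym (sum-remove g)) ⟩
    sum g + f i ∎

  sum-pair : ∀ {m} {f : Fin m → Carrier} x y → x ≢ y → (∀ z → z ≢ x → z ≢ y → f z ≈ 0#) → sum f ≈ f x + f y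
  sum-pair {m} {f} x y x≢y f≈0 = begin
    sum f                    ≈⟨ identityʳ (sum f) ⟨
    sum f + 0#               ≈⟨ ∙-congˡ (reflexive (sym g-x)) ⟩
    sum f + g x              ≈⟨ sum-exchange x (λ z z≢x → reflexive (sym (if-not z≢x))) ⟩
    sum g + f x              ≈⟨ ∙-congʳ (sum-single y g≈0) ⟩
    g y + f x                ≈⟨ ∙-congʳ (reflexive (if-not (λ y≡x → x≢y (sym y≡x)))) ⟩
    f y + f x                ≈⟨ comm (f y) (f x) ⟩
    f x + f y                ∎
    where
    g : Fin m → Carrier
    g z = if does (z ≟ x) then 0# else f z
    g-x : g x ≡ 0#
    g-x rewrite dec-true (x ≟ x) refl = refl
    if-not : ∀ {z} → z ≢ x → g z ≡ f z
    if-not {z} z≢x rewrite dec-false (z ≟ x) z≢x = refl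
    g≈0 : ∀ z → z ≢ y → g z ≈ 0#
    g≈0 z z≢y with z ≟ x
    ... | yes _   = ≈-refl
    ... | no z≢x  = f≈0 z z≢x z≢y

  sum-partition : ∀ {m k} (π : Fin m → Fin k) (f : Fin m → Carrier) →
                  sum f ≈ sum (λ p → sum (λ c → if does (π c ≟ p) then f c else 0#))
  sum-partition {m} {k} π f = begin
    sum f                          ≈⟨ sum-cong-≋ (λ c → ≈-sym (row c)) ⟩
    sum (λ c → sum (λ p → δ c p))  ≈⟨ ∑-comm δ ⟩
    sum (λ p → sum (λ c → δ c p))  ∎
    where
    δ : Fin m → Fin k → Carrier
    δ c p = if does (π c ≟ p) then f c else 0#
    off : ∀ c p → p ≢ π c → δ c p ≈ 0#
    off c p p≢πc rewrite dec-false (π c ≟ p) (λ πc≡p → p≢πc (sym πc≡p)) = ≈-refl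
    at : ∀ c → δ c (π c) ≡ f c
    at c rewrite dec-true (π c ≟ π c) refl = refl
    row : ∀ c → sum (δ c) ≈ f c
    row c = ≈-trans (sum-single (π c) (off c)) (reflexive (at c))

  ∑ᴸ : ∀ {n} → (Lab n → Carrier) → Carrier
  ∑ᴸ f = sum (λ i → sum (λ b → f (i , b)))

  module _ {n : ℕ} where

    ∑ᴸ-cong : {f g : Lab n → Carrier} → (∀ l → f l ≈ g l) → ∑ᴸ f ≈ ∑ᴸ g
    ∑ᴸ-cong f≈g = sum-cong-≋ (λ i → sum-cong-≋ (λ b → f≈g (i , b)))

    ∑ᴸ-zero : {f : Lab n → Carrier} → (∀ l → f l ≈ 0#) → ∑ᴸ f ≈ 0#
    ∑ᴸ-zero f≈0 = sum-zero (λ i → sum-zero (λ b → f≈0 (i , b)))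

    ∑ᴸ-single : {f : Lab n → Carrier} (l₀ : Lab n) → (∀ l → l ≢ l₀ → f l ≈ 0#) → ∑ᴸ f ≈ f l₀
    ∑ᴸ-single {f} (i₀ , b₀) f≈0 = ≈-trans
      (sum-single i₀ (λ i i≢i₀ → sum-zero (λ b → f≈0 (i , b) (i≢i₀ ∘′ cong proj₁))))
      (sum-single b₀ (λ b b≢b₀ → f≈0 (i₀ , b) (b≢b₀ ∘′ cong proj₂)))

    ∑ᴸ-distrib-+ : (f g : Lab n → Carrier) → ∑ᴸ (λ l → f l + g l) ≈ ∑ᴸ f + ∑ᴸ g
    ∑ᴸ-distrib-+ f g = ≈-trans (sum-cong-≋ (λ i → ∑-distrib-+ (λ b → f (i , b)) (λ b → g (i , b))))
                               (∑-distrib-+ (λ i → sum (λ b → f (i , b))) (λ i → sum (λ b → g (i , b))))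

    ∑ᴸ-update : (f : Lab n → Carrier) (i : Fin n) (g : Fin 3 → Carrier) →
                ∑ᴸ (f [ i ≔ g ]) + sum (λ b → f (i , b)) ≈ ∑ᴸ f + sum g
    ∑ᴸ-update f i g = ≈-trans
      (sum-exchange i (λ k k≢i → sum-cong-≋ (λ b → reflexive ([≔]-≢ {f = f} {g = g} b k≢i))))
      (∙-congˡ (sum-cong-≋ (λ b → reflexive ([≔]-≡ {f = f} {i = i} {g = g} b))))

module ℕΣ = FinSum ℕ.+-0-commutativeMonoid
module ℚΣ = FinSum ℚ.+-0-commutativeMonoid

countTrue≡sum : ∀ {m} (D : Fin m → Bool) → countTrue D ≡ ℕΣ.sum (bit ∘′ D)
countTrue≡sum {zero} D = refl
countTrue≡sum {suc m} D = cong (bit (D zero) ℕ.+_) (countTrue≡sum (D ∘′ suc))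

sumFin≡sum : ∀ {m} (f : Fin m → ℚ) → sumFin f ≡ ℚΣ.sum f
sumFin≡sum {zero} f = refl
sumFin≡sum {suc m} f = cong (f zero ℚ.+_) (sumFin≡sum (f ∘′ suc))

countTrue-cong : ∀ {m} {P P′ : Fin m → Bool} → (∀ c → P c ≡ P′ c) → countTrue P ≡ countTrue P′
countTrue-cong {zero}  _    = refl
countTrue-cong {suc m} P≡P′ = cong₂ (λ b r → bit b ℕ.+ r) (P≡P′ zero) (countTrue-cong (λ c → P≡P′ (suc c)))

sumFin-cong : ∀ {m} {f g : Fin m → ℚ} → (∀ c → f c ≡ g c) → sumFin f ≡ sumFin g
sumFin-cong {zero}  _   = refl
sumFin-cong {suc m} f≡g = cong₂ ℚ._+_ (f≡g zero) (sumFin-cong (λ c → f≡g (suc c)))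

sum-ones : ∀ m → ℕΣ.sum {m} (λ _ → 1) ≡ m
sum-ones zero    = refl
sum-ones (suc m) = cong suc (sum-ones m)

true≢false : true ≢ false
true≢false ()

∧≡true : ∀ {a b} → a ∧ b ≡ true → a ≡ true × b ≡ true
∧≡true e = ∧-conicalˡ _ _ e , ∧-conicalʳ _ _ e

not-both : ∀ {b} → not b ≡ true → b ≢ true
not-both {true}  ()
not-both {false} _ ()

module StretchAdj {n : ℕ} (adj : Lab n → Lab n → Bool) (i : Fin n) (A₁ A₂ : Lab n → Bool) where

  stretchAdj-outside : ∀ {j k} a b → j ≢ i → k ≢ i →
                       stretchAdj adj i A₁ A₂ (j , a) (k , b) ≡ adj (j , a) (k , b)
  stretchAdj-outside {j} {k} a b j≢i k≢i with j ≟ i | k ≟ i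
  ... | yes j≡i | _       = ⊥-elim (j≢i j≡i)
  ... | no _    | yes k≡i = ⊥-elim (k≢i k≡i)
  ... | no _    | no _    = refl

  stretchAdj-newˡ : ∀ {k} a b → k ≢ i → stretchAdj adj i A₁ A₂ (i , a) (k , b) ≡ newAdj a A₁ A₂ (k , b)
  stretchAdj-newˡ {k} a b k≢i with i ≟ i | k ≟ i
  ... | no i≢i | _       = ⊥-elim (i≢i refl)
  ... | yes _  | yes k≡i = ⊥-elim (k≢i k≡i)
  ... | yes _  | no _    = refl

  stretchAdj-inner : ∀ a b → stretchAdj adj i A₁ A₂ (i , a) (i , b) ≡ innerAdj a b
  stretchAdj-inner a b with i ≟ i
  ... | no i≢i = ⊥-elim (i≢i refl)
  ... | yes _  = refl

innerAdj-sym : ∀ a b → innerAdj a b ≡ innerAdj b a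
innerAdj-sym zero    zero    = refl
innerAdj-sym zero    (suc b) = refl
innerAdj-sym (suc a) zero    = refl
innerAdj-sym (suc a) (suc b) = refl

innerAdj-irrefl : ∀ a → innerAdj a a ≡ false
innerAdj-irrefl zero    = refl
innerAdj-irrefl (suc a) = refl

newAdj⊆ : ∀ {n} {A₁ A₂ P : Lab n → Bool} →
          (∀ u → A₁ u ≡ true → P u ≡ true) → (∀ u → A₂ u ≡ true → P u ≡ true) →
          ∀ a u → newAdj a A₁ A₂ u ≡ true → P u ≡ true
newAdj⊆ A₁⊆P A₂⊆P (suc zero)       u = A₁⊆P u
newAdj⊆ A₁⊆P A₂⊆P (suc (suc zero)) u = A₂⊆P u

valid-insertD : ∀ {n} (D : Fin n → Bool) i l → valid D l ≡ true → valid (insertD D i) l ≡ true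
valid-insertD D i (j , zero)  _ = refl
valid-insertD D i (j , suc a) v with j ≟ i
... | yes _ = refl
... | no _  = v

insertD-≡ : ∀ {n} (D : Fin n → Bool) i → insertD D i i ≡ true
insertD-≡ D i rewrite dec-true (i ≟ i) refl = refl

insertD-≢ : ∀ {n} (D : Fin n → Bool) {i j} → j ≢ i → insertD D i j ≡ D j
insertD-≢ D {i} {j} j≢i rewrite dec-false (j ≟ i) j≢i = refl

module _ {n : ℕ} where

  built-sym : ∀ {D adj} → Built n D adj → ∀ l l′ → adj l l′ ≡ adj l′ l
  built-sym base (i , zero) (j , zero) with i ≟ j | j ≟ i
  ... | yes _   | yes _   = refl
  ... | no _    | no _    = refl
  ... | yes i≡j | no j≢i  = ⊥-elim (j≢i (sym i≡j))
  ... | no i≢j  | yes j≡i = ⊥-elim (i≢j (sym j≡i))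
  built-sym base (i , zero)  (j , suc b) = refl
  built-sym base (i , suc a) (j , zero)  = refl
  built-sym base (i , suc a) (j , suc b) = refl
  built-sym (stretch B i _ _ _ _ _ _) (j , a) (k , b) with j ≟ i | k ≟ i
  ... | yes _ | yes _ = innerAdj-sym a b
  ... | yes _ | no _  = refl
  ... | no _  | yes _ = refl
  ... | no _  | no _  = built-sym B (j , a) (k , b)

  built-irrefl : ∀ {D adj} → Built n D adj → ∀ l → adj l l ≡ false
  built-irrefl base (i , zero) rewrite dec-true (i ≟ i) refl = refl
  built-irrefl base (i , suc a) = refl
  built-irrefl (stretch B i _ _ _ _ _ _) (j , a) with j ≟ i
  ... | yes _ = innerAdj-irrefl a
  ... | no _  = built-irrefl B (j , a)

  built-wings : ∀ {D adj} → Built n D adj → ∀ i a b → adj (i , suc a) (i , suc b) ≡ false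
  built-wings base i a b = refl
  built-wings (stretch B i′ _ _ _ _ _ _) i a b with i ≟ i′
  ... | yes _ = refl
  ... | no _  = built-wings B i a b

  built-valid : ∀ {D adj} → Built n D adj → ∀ l l′ → adj l l′ ≡ true → valid D l ≡ true
  built-valid base (i , zero) l′ _ = refl
  built-valid (stretch {D = D} B i _ A₁ A₂ A₁⊆N A₂⊆N _) (j , a) (k , b) e with j ≟ i | k ≟ i
  ... | yes j≡i | _ = wing-valid a
    where
    wing-valid : ∀ a → valid (insertD D i) (j , a) ≡ true
    wing-valid zero    = refl
    wing-valid (suc a) rewrite j≡i = insertD-≡ D i
  ... | no _ | yes _ = valid-insertD D i (j , a) (built-valid B (j , a) (i , zero)
                         (trans (built-sym B (j , a) (i , zero)) (newAdj⊆ A₁⊆N A₂⊆N b (j , a) e)))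
  ... | no _ | no _  = valid-insertD D i (j , a) (built-valid B (j , a) (k , b) e)

  built-hub : ∀ {D adj} → Built n D adj → ∀ i l → D i ≡ true → adj (i , zero) l ≡ true →
              proj₁ l ≡ i × proj₂ l ≢ zero
  built-hub (stretch B i′ _ A₁ A₂ A₁⊆N A₂⊆N _) i (k , b) Di e with i ≟ i′ | k ≟ i′
  ... | yes i≡i′ | yes k≡i′ = trans k≡i′ (sym i≡i′) , inner-wing b e
    where
    inner-wing : ∀ b → innerAdj zero b ≡ true → b ≢ zero
    inner-wing (suc b) _ ()
  ... | no i≢i′ | yes _ = ⊥-elim (i≢i′ (sym (proj₁ (built-hub B i (i′ , zero) Di
                            (trans (built-sym B (i , zero) (i′ , zero)) (newAdj⊆ A₁⊆N A₂⊆N b (i , zero) e))))))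
  ... | no _ | no _ = built-hub B i (k , b) Di e

module _ {n : ℕ} where

  StableLab : (Lab n → Lab n → Bool) → (Lab n → Bool) → Set
  StableLab adj S = ∀ l l′ → S l ≡ true → S l′ ≡ true → adj l l′ ≡ false

  OnValid : (Fin n → Bool) → (Lab n → Bool) → Set
  OnValid D S = ∀ l → S l ≡ true → valid D l ≡ true

  size : (Lab n → Bool) → ℕ
  size S = ℕΣ.∑ᴸ (bit ∘′ S)

  groupSize : (Lab n → Bool) → Fin n → ℕ
  groupSize S i = ℕΣ.sum (λ b → bit (S (i , b)))

  size-update : ∀ S i g → size (S [ i ≔ g ]) ℕ.+ groupSize S i ≡ size S ℕ.+ ℕΣ.sum (bit ∘′ g)
  size-update S i g = trans (cong (ℕ._+ groupSize S i) (ℕΣ.∑ᴸ-cong ([≔]-map bit S i g)))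
                            (ℕΣ.∑ᴸ-update (bit ∘′ S) i (bit ∘′ g))

  countTrue-insertD : ∀ (D : Fin n → Bool) i → D i ≡ false → countTrue (insertD D i) ≡ suc (countTrue D)
  countTrue-insertD D i Di = begin
    countTrue (insertD D i)                                  ≡⟨ countTrue≡sum (insertD D i) ⟩
    ℕΣ.sum (bit ∘′ insertD D i)                              ≡⟨ ℕ.+-identityʳ _ ⟨
    ℕΣ.sum (bit ∘′ insertD D i) ℕ.+ 0                        ≡⟨ cong (λ b → ℕΣ.sum (bit ∘′ insertD D i) ℕ.+ bit b) Di ⟨
    ℕΣ.sum (bit ∘′ insertD D i) ℕ.+ bit (D i)                ≡⟨ ℕΣ.sum-exchange i (λ j j≢i → cong bit (insertD-≢ D j≢i)) ⟩
    ℕΣ.sum (bit ∘′ D) ℕ.+ bit (insertD D i i)                ≡⟨ cong (λ b → ℕΣ.sum (bit ∘′ D) ℕ.+ bit b) (insertD-≡ D i) ⟩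
    ℕΣ.sum (bit ∘′ D) ℕ.+ 1                                  ≡⟨ ℕ.+-comm _ 1 ⟩
    suc (ℕΣ.sum (bit ∘′ D))                                  ≡⟨ cong suc (countTrue≡sum D) ⟨
    suc (countTrue D)                                        ∎
    where open ≡-Reasoning

countTrue-≡0 : ∀ {m} (P : Fin m → Bool) → (∀ x → P x ≡ false) → countTrue P ≡ 0
countTrue-≡0 {zero}  P _   = refl
countTrue-≡0 {suc m} P P≡f rewrite P≡f zero = countTrue-≡0 (P ∘′ suc) (λ x → P≡f (suc x))

countTrue-≤1 : ∀ {m} (P : Fin m → Bool) → (∀ x y → P x ≡ true → P y ≡ true → x ≡ y) → countTrue P ≤ 1
countTrue-≤1 {zero}  P _ = z≤n
countTrue-≤1 {suc m} P unique with P zero in P0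
... | true  = s≤s (ℕ.≤-reflexive (countTrue-≡0 (P ∘′ suc) (λ x → ¬-not (λ Px → zero≢suc (unique zero (suc x) P0 Px)))))
  where
  zero≢suc : ∀ {x : Fin m} → zero ≢ suc x
  zero≢suc ()
... | false = countTrue-≤1 (P ∘′ suc) (λ x y Px Py → suc-injective (unique (suc x) (suc y) Px Py))

module _ {n : ℕ} where

  size-wingless : (S : Lab n → Bool) → (∀ i a → S (i , suc a) ≡ false) → size S ≡ countTrue (λ i → S (i , zero))
  size-wingless S wingless = trans (ℕΣ.sum-cong-≋ group) (sym (countTrue≡sum (λ i → S (i , zero))))
    where
    group : ∀ i → groupSize S i ≡ bit (S (i , zero))
    group i rewrite wingless i zero | wingless i (suc zero) = ℕ.+-identityʳ _

  collapse : (Lab n → Bool) → Fin n → Fin 3 → Bool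
  collapse S i zero    = S (i , suc zero) ∧ S (i , suc (suc zero))
  collapse S i (suc _) = false

  unstretch : Fin n → (Lab n → Bool) → Lab n → Bool
  unstretch i S = S [ i ≔ collapse S i ]

  module _ {D adj} (B : Built n D adj) {i : Fin n} {A₁ A₂ : Lab n → Bool}
           (cover : ∀ u → adj (i , zero) u ≡ true → A₁ u ≡ true ⊎ A₂ u ≡ true)
           {S : Lab n → Bool} (stable : StableLab (stretchAdj adj i A₁ A₂) S) where

    open StretchAdj adj i A₁ A₂

    private
      wing-misses : ∀ {k} a b → k ≢ i → S (i , suc a) ≡ true → S (k , b) ≡ true → newAdj (suc a) A₁ A₂ (k , b) ≡ false
      wing-misses a b k≢i Sw Sk = trans (sym (stretchAdj-newˡ (suc a) b k≢i)) (stable (i , suc a) (_ , b) Sw Sk)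

      old-vertex-misses : ∀ {k} b → k ≢ i → collapse S i zero ≡ true → S (k , b) ≡ true →
                          adj (i , zero) (k , b) ≡ false
      old-vertex-misses b k≢i S₀i Sk with ∧≡true S₀i
      ... | Sw₁ , Sw₂ = ¬-not λ e → [ (λ A₁u → true≢false (trans (sym A₁u) (wing-misses zero b k≢i Sw₁ Sk)))
                                    , (λ A₂u → true≢false (trans (sym A₂u) (wing-misses (suc zero) b k≢i Sw₂ Sk))) ]′
                                    (cover (_ , b) e)

      hub-excludes-wing : S (i , zero) ≡ true → ∀ a → S (i , suc a) ≡ false
      hub-excludes-wing S₀ a = ¬-not λ Sw → true≢false
        (trans (sym (stretchAdj-inner zero (suc a))) (stable (i , zero) (i , suc a) S₀ Sw))

    unstretch-stable : StableLab adj (unstretch i S)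
    unstretch-stable (j , a) (k , b) Sj Sk with j ≟ i | k ≟ i
    ... | no j≢i | no k≢i = trans (sym (stretchAdj-outside a b j≢i k≢i)) (stable (j , a) (k , b) Sj Sk)
    unstretch-stable (j , zero) (k , b) Sj Sk | yes refl | no k≢i = old-vertex-misses b k≢i Sj Sk
    unstretch-stable (j , a) (k , zero) Sj Sk | no j≢i | yes refl =
      trans (built-sym B (j , a) (k , zero)) (old-vertex-misses a j≢i Sk Sj)
    unstretch-stable (j , zero) (k , zero) Sj Sk | yes refl | yes refl = built-irrefl B (j , zero)

    groupSize-≤ : groupSize S i ≤ suc (ℕΣ.sum (bit ∘′ collapse S i))
    groupSize-≤ with S (i , zero) in S₀
    ... | true rewrite hub-excludes-wing S₀ zero | hub-excludes-wing S₀ (suc zero) = s≤s z≤n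
    ... | false with S (i , suc zero) | S (i , suc (suc zero))
    ...   | true  | true  = s≤s (s≤s z≤n)
    ...   | true  | false = s≤s z≤n
    ...   | false | true  = s≤s z≤n
    ...   | false | false = z≤n

  unstretch-onValid : ∀ D i S → OnValid (insertD D i) S → OnValid D (unstretch i S)
  unstretch-onValid D i S valid (k , zero)  _  = refl
  unstretch-onValid D i S valid (k , suc b) Sk with k ≟ i
  ... | no k≢i = trans (sym (insertD-≢ D k≢i)) (valid (k , suc b) Sk)

  size-stable-≤ : ∀ {D adj} → Built n D adj → ∀ S → OnValid D S → StableLab adj S → size S ≤ suc (countTrue D)
  size-stable-≤ base S valid stable = begin
    size S
      ≡⟨ size-wingless S (λ i a → ¬-not (λ Sw → true≢false (sym (valid (i , suc a) Sw)))) ⟩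
    countTrue (λ i → S (i , zero))
      ≤⟨ countTrue-≤1 _ (λ i j Si Sj → same-vertex i j (stable (i , zero) (j , zero) Si Sj)) ⟩
    1
      ≡⟨ cong suc (countTrue-≡0 {n} _ (λ _ → refl)) ⟨
    suc (countTrue {n} (λ _ → false)) ∎
    where
    open ℕ.≤-Reasoning
    same-vertex : ∀ i j → Kadj (i , zero) (j , zero) ≡ false → i ≡ j
    same-vertex i j _ with i ≟ j
    same-vertex i j _  | yes i≡j = i≡j
    same-vertex i j () | no _
  size-stable-≤ (stretch {D = D} {adj} B i Di A₁ A₂ _ _ cover) S valid stable =
    ℕ.+-cancelʳ-≤ c (size S) (suc (countTrue (insertD D i))) (begin
      size S ℕ.+ c                                  ≡⟨ size-update S i (collapse S i) ⟨
      size (unstretch i S) ℕ.+ groupSize S i        ≤⟨ ℕ.+-mono-≤ size-old (groupSize-≤ B cover stable) ⟩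
      suc (countTrue D) ℕ.+ suc c                   ≡⟨ cong suc (ℕ.+-suc (countTrue D) c) ⟩
      suc (suc (countTrue D)) ℕ.+ c                 ≡⟨ cong (λ m → suc m ℕ.+ c) (countTrue-insertD D i Di) ⟨
      suc (countTrue (insertD D i)) ℕ.+ c           ∎)
    where
    open ℕ.≤-Reasoning
    c : ℕ
    c = ℕΣ.sum (bit ∘′ collapse S i)
    size-old : size (unstretch i S) ≤ suc (countTrue D)
    size-old = size-stable-≤ B (unstretch i S) (unstretch-onValid D i S valid) (unstretch-stable B cover stable)

-- Hubs together with the top of one group

another : ∀ {n} → 2 ≤ n → (g : Fin n) → ∃[ h ] h ≢ g
another {suc (suc _)} _         g = punchIn g zero , punchInᵢ≢i g zero
another {suc zero}    (s≤s ()) _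

module _ {n : ℕ} where

  hubs : (Fin n → Bool) → Lab n → Bool
  hubs D (g , zero)  = D g
  hubs D (g , suc _) = false

  top : (Fin n → Bool) → Fin n → Fin 3 → Bool
  top D j zero    = not (D j)
  top D j (suc _) = D j

  hubsTop : (Fin n → Bool) → Fin n → Lab n → Bool
  hubsTop D j = hubs D [ j ≔ top D j ]

  size-hubs : ∀ D → size (hubs D) ≡ countTrue D
  size-hubs D = size-wingless (hubs D) (λ _ _ → refl)

  hubs-onValid : ∀ D → OnValid D (hubs D)
  hubs-onValid D (g , zero) _ = refl

  size-hubsTop : ∀ D j → size (hubsTop D j) ≡ suc (countTrue D)
  size-hubsTop D j = ℕ.+-cancelʳ-≡ (bit (D j)) _ _ (begin
    size (hubsTop D j) ℕ.+ bit (D j)      ≡⟨ cong (size (hubsTop D j) ℕ.+_) (ℕ.+-identityʳ (bit (D j))) ⟨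
    size (hubsTop D j) ℕ.+ groupSize (hubs D) j  ≡⟨ size-update (hubs D) j (top D j) ⟩
    size (hubs D) ℕ.+ ℕΣ.sum (bit ∘′ top D j)    ≡⟨ cong₂ ℕ._+_ (size-hubs D) (top-size (D j)) ⟩
    countTrue D ℕ.+ suc (bit (D j))              ≡⟨ ℕ.+-suc (countTrue D) (bit (D j)) ⟩
    suc (countTrue D) ℕ.+ bit (D j)              ∎)
    where
    open ≡-Reasoning
    top-size : ∀ b → bit (not b) ℕ.+ (bit b ℕ.+ (bit b ℕ.+ 0)) ≡ suc (bit b)
    top-size true  = refl
    top-size false = refl

  hubsTop-onValid : ∀ D j → OnValid D (hubsTop D j)
  hubsTop-onValid D j (g , zero)  _ = refl
  hubsTop-onValid D j (g , suc a) e with g ≟ j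
  ... | yes refl = e

  hubsTop-member : ∀ D j g b → hubsTop D j (g , b) ≡ true → (b ≡ zero × D g ≡ true) ⊎ (g ≡ j × top D j b ≡ true)
  hubsTop-member D j g b e with g ≟ j
  hubsTop-member D j g zero e | no _ = inj₁ (refl , e)
  ... | yes g≡j = inj₂ (g≡j , e)

  module _ {D adj} (B : Built n D adj) (j : Fin n) where

    private
      top-stable : ∀ a b → top D j a ≡ true → top D j b ≡ true → adj (j , a) (j , b) ≡ false
      top-stable zero    zero    _ _  = built-irrefl B (j , zero)
      top-stable (suc a) (suc b) _ _  = built-wings B j a b
      top-stable zero    (suc b) t t′ = ⊥-elim (not-both t t′)
      top-stable (suc a) zero    t t′ = ⊥-elim (not-both t′ t)

      hub-isolated : ∀ {g g′ b′} → D g ≡ true → hubsTop D j (g , zero) ≡ true →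
                     (b′ ≡ zero × D g′ ≡ true) ⊎ (g′ ≡ j × top D j b′ ≡ true) →
                     adj (g , zero) (g′ , b′) ≡ false
      hub-isolated {g} {g′} {b′} Dg Sg m′ = ¬-not λ e → excluded (built-hub B g (g′ , b′) Dg e) m′
        where
        excluded : ∀ {b′} → g′ ≡ g × b′ ≢ zero → (b′ ≡ zero × D g′ ≡ true) ⊎ (g′ ≡ j × top D j b′ ≡ true) → ⊥
        excluded (_ , b′≢0) (inj₁ (b′≡0 , _)) = b′≢0 b′≡0
        excluded {zero}  (_ , b′≢0) (inj₂ _) = b′≢0 refl
        excluded {suc _} (refl , _) (inj₂ (refl , t)) =
          not-both (trans (sym ([≔]-≡ {f = hubs D} {i = j} {g = top D j} zero)) Sg) t

    hubsTop-stable : StableLab adj (hubsTop D j)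
    hubsTop-stable (g , b) (g′ , b′) Sl Sl′ with hubsTop-member D j g b Sl | hubsTop-member D j g′ b′ Sl′
    ... | inj₁ (refl , Dg) | m′ = hub-isolated Dg Sl m′
    ... | inj₂ _ | inj₁ (refl , Dg′) =
      trans (built-sym B (g , b) (g′ , zero)) (hub-isolated Dg′ Sl′ (hubsTop-member D j g b Sl))
    ... | inj₂ (refl , t) | inj₂ (refl , t′) = top-stable _ _ t t′

  hubsTop-covers : 2 ≤ n → ∀ D l → valid D l ≡ true → ∃[ h ] hubsTop D h l ≡ true
  hubsTop-covers 2≤n D (g , zero) _ = by-cases (D g) refl
    where
    by-cases : ∀ b → D g ≡ b → ∃[ h ] hubsTop D h (g , zero) ≡ true
    by-cases false Dg = g , trans ([≔]-≡ {f = hubs D} {i = g} {g = top D g} zero) (cong not Dg)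
    by-cases true  Dg with another 2≤n g
    ... | h , h≢g = h , trans ([≔]-≢ {f = hubs D} {g = top D h} zero (λ g≡h → h≢g (sym g≡h))) Dg
  hubsTop-covers 2≤n D (g , suc a) Dg = g , trans ([≔]-≡ {f = hubs D} {i = g} {g = top D g} (suc a)) Dg

  hubs-edge : ∀ D {i} → D i ≡ true → ∀ ℓ → bit (hubs D (i , zero)) ℕ.+ bit (hubs D (i , suc ℓ)) ≡ 1
  hubs-edge D Di ℓ rewrite Di = refl

  hubsTop-edge : ∀ D h {i} → D i ≡ true → ∀ ℓ → bit (hubsTop D h (i , zero)) ℕ.+ bit (hubsTop D h (i , suc ℓ)) ≡ 1
  hubsTop-edge D h {i} Di ℓ with i ≟ h
  ... | yes refl rewrite Di = refl
  ... | no _     rewrite Di = refl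

-- Extending stable sets through a stretching

onlyWing : Fin 2 → Fin 3 → Bool
onlyWing a b = does (b ≟ suc a)

module _ {n : ℕ} where

  stretchGroup : (Lab n → Bool) → Fin n → Fin 3 → Bool
  stretchGroup S i zero    = not (S (i , zero))
  stretchGroup S i (suc _) = S (i , zero)

  stretchSet : Fin n → (Lab n → Bool) → Lab n → Bool
  stretchSet i S = S [ i ≔ stretchGroup S i ]

  stretchSet-≡ : ∀ i S b → stretchSet i S (i , b) ≡ stretchGroup S i b
  stretchSet-≡ i S = [≔]-≡ {f = S} {i = i} {g = stretchGroup S i}

  stretchSet-≢ : ∀ {i k} S b → k ≢ i → stretchSet i S (k , b) ≡ S (k , b)
  stretchSet-≢ {i} S = [≔]-≢ {f = S} {i = i} {g = stretchGroup S i}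

  stretchSet-onValid : ∀ D i S → OnValid D S → OnValid (insertD D i) (stretchSet i S)
  stretchSet-onValid D i S valid (k , zero)  _ = refl
  stretchSet-onValid D i S valid (k , suc b) e with k ≟ i
  ... | yes _ = refl
  ... | no _  = valid (k , suc b) e

  size-stretchSet : ∀ D i S → D i ≡ false → OnValid D S → size (stretchSet i S) ≡ suc (size S)
  size-stretchSet D i S Di valid = ℕ.+-cancelʳ-≡ (bit (S (i , zero))) _ _ (begin
    size (stretchSet i S) ℕ.+ bit (S (i , zero))    ≡⟨ cong (size (stretchSet i S) ℕ.+_) group-old ⟩
    size (stretchSet i S) ℕ.+ groupSize S i         ≡⟨ size-update S i (stretchGroup S i) ⟩
    size S ℕ.+ ℕΣ.sum (bit ∘′ stretchGroup S i)     ≡⟨ cong (size S ℕ.+_) (group-new (S (i , zero))) ⟩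
    size S ℕ.+ suc (bit (S (i , zero)))             ≡⟨ ℕ.+-suc (size S) _ ⟩
    suc (size S) ℕ.+ bit (S (i , zero))             ∎)
    where
    open ≡-Reasoning
    wing-absent : ∀ a → S (i , suc a) ≡ false
    wing-absent a = ¬-not λ Sw → true≢false (trans (sym (valid (i , suc a) Sw)) Di)
    group-old : bit (S (i , zero)) ≡ groupSize S i
    group-old rewrite wing-absent zero | wing-absent (suc zero) = sym (ℕ.+-identityʳ _)
    group-new : ∀ x → bit (not x) ℕ.+ (bit x ℕ.+ (bit x ℕ.+ 0)) ≡ suc (bit x)
    group-new true  = refl
    group-new false = refl

  module _ {D adj} (B : Built n D adj) {i : Fin n} {A₁ A₂ : Lab n → Bool}
           (A₁⊆N : ∀ u → A₁ u ≡ true → adj (i , zero) u ≡ true)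
           (A₂⊆N : ∀ u → A₂ u ≡ true → adj (i , zero) u ≡ true)
           {S : Lab n → Bool} (stable : StableLab adj S) where

    open StretchAdj adj i A₁ A₂

    private
      new-misses-old : ∀ {k} a b → k ≢ i → stretchGroup S i a ≡ true → S (k , b) ≡ true →
                       newAdj a A₁ A₂ (k , b) ≡ false
      new-misses-old zero    b k≢i _ _ = refl
      new-misses-old (suc a) b k≢i Si Sk = ¬-not λ e → true≢false (trans (sym (newAdj⊆ A₁⊆N A₂⊆N (suc a) _ e))
        (stable (i , zero) _ Si Sk))

      inner-stable : ∀ a b → stretchGroup S i a ≡ true → stretchGroup S i b ≡ true → innerAdj a b ≡ false
      inner-stable zero    zero    _ _ = refl
      inner-stable (suc a) (suc b) _ _ = refl
      inner-stable zero    (suc b) t t′ = ⊥-elim (not-both t t′)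
      inner-stable (suc a) zero    t t′ = ⊥-elim (not-both t′ t)

    stretchSet-stable : StableLab (stretchAdj adj i A₁ A₂) (stretchSet i S)
    stretchSet-stable (j , a) (k , b) Sj Sk with j ≟ i | k ≟ i
    ... | no _     | no _     = stable (j , a) (k , b) Sj Sk
    ... | yes refl | no k≢i   = new-misses-old {k} a b k≢i Sj Sk
    ... | no j≢i   | yes refl = new-misses-old {j} b a j≢i Sk Sj
    ... | yes refl | yes refl = inner-stable a b Sj Sk

  wingSet : (Fin n → Bool) → Fin n → Fin n → Fin 2 → Lab n → Bool
  wingSet D i j a = hubsTop D j [ i ≔ onlyWing a ]

  wingSet-onValid : ∀ D i j a → OnValid (insertD D i) (wingSet D i j a)
  wingSet-onValid D i j a (k , zero)  _ = refl
  wingSet-onValid D i j a (k , suc b) e with k ≟ i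
  ... | yes _ = refl
  ... | no _  = hubsTop-onValid D j (k , suc b) e

  size-wingSet : ∀ D i j a → D i ≡ false → j ≢ i → size (wingSet D i j a) ≡ suc (suc (countTrue D))
  size-wingSet D i j a Di j≢i = begin
    size (wingSet D i j a)                                      ≡⟨ ℕ.+-identityʳ _ ⟨
    size (wingSet D i j a) ℕ.+ 0                                ≡⟨ cong (size (wingSet D i j a) ℕ.+_) group-old ⟨
    size (wingSet D i j a) ℕ.+ groupSize (hubsTop D j) i        ≡⟨ size-update (hubsTop D j) i (onlyWing a) ⟩
    size (hubsTop D j) ℕ.+ ℕΣ.sum (bit ∘′ onlyWing a)           ≡⟨ cong₂ ℕ._+_ (size-hubsTop D j) (group-new a) ⟩
    suc (countTrue D) ℕ.+ 1                                     ≡⟨ ℕ.+-comm _ 1 ⟩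
    suc (suc (countTrue D))                                     ∎
    where
    open ≡-Reasoning
    i≢j : i ≢ j
    i≢j i≡j = j≢i (sym i≡j)
    group-old : groupSize (hubsTop D j) i ≡ 0
    group-old rewrite [≔]-≢ {f = hubs D} {g = top D j} zero i≢j
                    | [≔]-≢ {f = hubs D} {g = top D j} (suc zero) i≢j
                    | Di = refl
    group-new : ∀ a → ℕΣ.sum (bit ∘′ onlyWing a) ≡ 1
    group-new zero       = refl
    group-new (suc zero) = refl

  module _ {D adj} (B : Built n D adj) {i : Fin n} {A₁ A₂ : Lab n → Bool}
           (A₁⊆N : ∀ u → A₁ u ≡ true → adj (i , zero) u ≡ true)
           (A₂⊆N : ∀ u → A₂ u ≡ true → adj (i , zero) u ≡ true)
           {j : Fin n} (a : Fin 2) (j≢i : j ≢ i) (avoid : ∀ b → newAdj (suc a) A₁ A₂ (j , b) ≡ false) where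

    private
      wing-misses : ∀ {k} b → k ≢ i → hubsTop D j (k , b) ≡ true → newAdj (suc a) A₁ A₂ (k , b) ≡ false
      wing-misses {k} b k≢i Sk with hubsTop-member D j k b Sk
      ... | inj₂ (refl , _) = avoid b
      ... | inj₁ (refl , Dk) = ¬-not λ e → k≢i (sym (proj₁ (built-hub B k (i , zero) Dk
              (trans (built-sym B (k , zero) (i , zero)) (newAdj⊆ A₁⊆N A₂⊆N (suc a) (k , zero) e)))))

      at-wing : ∀ b (P : Fin 3 → Set) → onlyWing a b ≡ true → P (suc a) → P b
      at-wing b P e with b ≟ suc a
      ... | yes refl = λ p → p

    wingSet-stable : StableLab (stretchAdj adj i A₁ A₂) (wingSet D i j a)
    wingSet-stable (k , b) (k′ , b′) Sk Sk′ with k ≟ i | k′ ≟ i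
    ... | no _     | no _     = hubsTop-stable B j (k , b) (k′ , b′) Sk Sk′
    ... | yes refl | no k′≢i  = at-wing b (λ c → newAdj c A₁ A₂ (k′ , b′) ≡ false) Sk (wing-misses b′ k′≢i Sk′)
    ... | no k≢i   | yes refl = at-wing b′ (λ c → newAdj c A₁ A₂ (k , b) ≡ false) Sk′ (wing-misses b k≢i Sk)
    ... | yes refl | yes refl =
      at-wing b (λ c → innerAdj c b′ ≡ false) Sk (at-wing b′ (λ c → innerAdj (suc a) c ≡ false) Sk′ refl)

-- A family of maximum stable sets

module _ {n : ℕ} where

  _≟ᴸ_ : (l l′ : Lab n) → Dec (l ≡ l′)
  _≟ᴸ_ = ≡-dec _≟_ _≟_

  singleton : Lab n → Lab n → Bool
  singleton l m = does (m ≟ᴸ l)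

  singleton-member : ∀ {l m} → singleton l m ≡ true → m ≡ l
  singleton-member {l} {m} e with m ≟ᴸ l
  ... | yes m≡l = m≡l

  size-singleton : ∀ l → size (singleton l) ≡ 1
  size-singleton l = trans (ℕΣ.∑ᴸ-single l (λ m m≢l → cong bit (dec-false (m ≟ᴸ l) m≢l)))
                           (cong bit (dec-true (l ≟ᴸ l) refl))

  Avoids : (Lab n → Bool) → Fin n → Set
  Avoids A i = ∃[ j ] j ≢ i × (∀ b → A (j , b) ≡ false)

  WingsAvoid : ∀ {D adj} → Built n D adj → Set
  WingsAvoid base = ⊤
  WingsAvoid (stretch B i _ A₁ A₂ _ _ _) = WingsAvoid B × (∀ a → Avoids (newAdj (suc a) A₁ A₂) i)

  family : ∀ {D adj} (B : Built n D adj) → WingsAvoid B → Lab n → Lab n → Bool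
  family base _ (j , zero)  = singleton (j , zero)
  family base _ (j , suc _) = λ _ → false
  family (stretch B i _ _ _ _ _ _) (w , _) (k , zero) = stretchSet i (family B w (k , zero))
  family (stretch {D = D} B i _ _ _ _ _ _) (w , avoid) (k , suc a) with k ≟ i
  ... | yes _ = wingSet D i (proj₁ (avoid a)) a
  ... | no _  = stretchSet i (family B w (k , suc a))

  family-onValid : ∀ {D adj} (B : Built n D adj) w l → OnValid D (family B w l)
  family-onValid base _ (j , zero) m e = subst (λ m → valid _ m ≡ true) (sym (singleton-member {j , zero} {m} e)) refl
  family-onValid (stretch {D = D} B i _ _ _ _ _ _) (w , _) (k , zero) =
    stretchSet-onValid D i _ (family-onValid B w (k , zero))
  family-onValid (stretch {D = D} B i _ _ _ _ _ _) (w , avoid) (k , suc a) with k ≟ i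
  ... | yes _ = wingSet-onValid D i _ a
  ... | no _  = stretchSet-onValid D i _ (family-onValid B w (k , suc a))

  family-stable : ∀ {D adj} (B : Built n D adj) w l → StableLab adj (family B w l)
  family-stable base _ (j , zero) m m′ e e′
    with singleton-member {j , zero} {m} e | singleton-member {j , zero} {m′} e′
  ... | refl | refl = built-irrefl base (j , zero)
  family-stable (stretch B i _ _ _ A₁⊆N A₂⊆N _) (w , _) (k , zero) =
    stretchSet-stable B A₁⊆N A₂⊆N (family-stable B w (k , zero))
  family-stable (stretch B i Di _ _ A₁⊆N A₂⊆N _) (w , avoid) (k , suc a) with k ≟ i
  ... | yes _ = wingSet-stable B A₁⊆N A₂⊆N a (proj₁ (proj₂ (avoid a))) (proj₂ (proj₂ (avoid a)))
  ... | no _  = stretchSet-stable B A₁⊆N A₂⊆N (family-stable B w (k , suc a))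

  size-stretchSet-tight : ∀ {D : Fin n → Bool} i S → D i ≡ false → OnValid D S → size S ≡ suc (countTrue D) →
                          size (stretchSet i S) ≡ suc (countTrue (insertD D i))
  size-stretchSet-tight {D} i S Di onValid tight = begin
    size (stretchSet i S)            ≡⟨ size-stretchSet D i S Di onValid ⟩
    suc (size S)                     ≡⟨ cong suc tight ⟩
    suc (suc (countTrue D))          ≡⟨ cong suc (countTrue-insertD D i Di) ⟨
    suc (countTrue (insertD D i))    ∎
    where open ≡-Reasoning

  size-family : ∀ {D adj} (B : Built n D adj) w l → valid D l ≡ true → size (family B w l) ≡ suc (countTrue D)
  size-family base _ (j , zero) _ = trans (size-singleton (j , zero)) (cong suc (sym (countTrue-≡0 {n} _ (λ _ → refl))))
  size-family (stretch B i Di _ _ _ _ _) (w , _) (k , zero) _ =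
    size-stretchSet-tight i (family B w (k , zero)) Di (family-onValid B w (k , zero)) (size-family B w (k , zero) refl)
  size-family (stretch {D = D} B i Di _ _ _ _ _) (w , avoid) (k , suc a) v with k ≟ i
  ... | yes _ = trans (size-wingSet D i _ a Di (proj₁ (proj₂ (avoid a)))) (cong suc (sym (countTrue-insertD D i Di)))
  ... | no _  = size-stretchSet-tight i (family B w (k , suc a)) Di (family-onValid B w (k , suc a))
                  (size-family B w (k , suc a) v)

-- Affine independence of the family

+-vanishʳ : ∀ {x y} → y ≡ 0ℚ → x ℚ.+ y ≡ x
+-vanishʳ {x} refl = ℚ.+-identityʳ x

linear-system : ∀ {A l₁ l₂} → A ℚ.+ l₁ ≡ 0ℚ → A ℚ.+ l₂ ≡ 0ℚ → A ℚ.+ (l₁ ℚ.+ l₂) ≡ 0ℚ → A ≡ 0ℚ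
linear-system {A} {l₁} {l₂} e₁ e₂ e₁₂ = begin
  A
    ≡⟨ solve 3 (λ A l₁ l₂ → A := (A :+ l₁) :+ (A :+ l₂) :- (A :+ (l₁ :+ l₂))) refl A l₁ l₂ ⟩
  (A ℚ.+ l₁) ℚ.+ (A ℚ.+ l₂) ℚ.- (A ℚ.+ (l₁ ℚ.+ l₂))
    ≡⟨ cong₂ (λ x y → x ℚ.- y) (cong₂ ℚ._+_ e₁ e₂) e₁₂ ⟩
  0ℚ ∎
  where
  open ≡-Reasoning
  open +-*-Solver using (solve; _:=_; _:+_; _:-_)

hubPart : ℚ → Fin 3 → ℚ
hubPart x zero    = x
hubPart x (suc _) = 0ℚ

module _ {n : ℕ} where

  open +-*-Solver using (solve; _:=_; _:+_; _:-_; _:*_; con)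

  combination : (Lab n → ℚ) → (Lab n → Lab n → Bool) → Lab n → ℚ
  combination μ Q c = ℚΣ.∑ᴸ (λ m → μ m ℚ.* indicator (Q m c))

  AffinelyIndependentᴸ : (Fin n → Bool) → (Lab n → Lab n → Bool) → Set
  AffinelyIndependentᴸ D Q = ∀ (μ : Lab n → ℚ) → (∀ l → valid D l ≡ false → μ l ≡ 0ℚ) → ℚΣ.∑ᴸ μ ≡ 0ℚ →
    (∀ c → valid D c ≡ true → combination μ Q c ≡ 0ℚ) → ∀ l → μ l ≡ 0ℚ

  dropWings : Fin n → (Lab n → ℚ) → Lab n → ℚ
  dropWings i f = f [ i ≔ hubPart (f (i , zero)) ]

  ∑ᴸ-dropWings : ∀ i f → ℚΣ.∑ᴸ f ≡ ℚΣ.∑ᴸ (dropWings i f) ℚ.+ (f (i , suc zero) ℚ.+ f (i , suc (suc zero)))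
  ∑ᴸ-dropWings i f = begin
    ℚΣ.∑ᴸ f
      ≡⟨ solve 2 (λ s t → s := (s :+ t) :- t) refl (ℚΣ.∑ᴸ f) t ⟩
    (ℚΣ.∑ᴸ f ℚ.+ t) ℚ.- t
      ≡⟨ cong (ℚ._- t) (ℚΣ.∑ᴸ-update f i (hubPart (f (i , zero)))) ⟨
    (ℚΣ.∑ᴸ (dropWings i f) ℚ.+ u) ℚ.- t
      ≡⟨ solve 4 (λ x f₀ f₁ f₂ → (x :+ (f₀ :+ (f₁ :+ (f₂ :+ con 0ℚ)))) :- (f₀ :+ (con 0ℚ :+ (con 0ℚ :+ con 0ℚ)))
                                  := x :+ (f₁ :+ f₂))
                 refl (ℚΣ.∑ᴸ (dropWings i f)) (f (i , zero)) (f (i , suc zero)) (f (i , suc (suc zero))) ⟩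
    ℚΣ.∑ᴸ (dropWings i f) ℚ.+ (f (i , suc zero) ℚ.+ f (i , suc (suc zero))) ∎
    where
    open ≡-Reasoning
    t u : ℚ
    t = ℚΣ.sum (hubPart (f (i , zero)))
    u = ℚΣ.sum (λ b → f (i , b))

  module _ (ν : Lab n → ℚ) (F : Lab n → Lab n → Bool) (i : Fin n) where

    combination-stretchSet-≢ : ∀ {k} b → k ≢ i → combination ν (λ m → stretchSet i (F m)) (k , b) ≡ combination ν F (k , b)
    combination-stretchSet-≢ b k≢i = ℚΣ.∑ᴸ-cong (λ m → cong (λ x → ν m ℚ.* indicator x) (stretchSet-≢ (F m) b k≢i))

    combination-stretchSet-wing : ∀ a → combination ν (λ m → stretchSet i (F m)) (i , suc a) ≡ combination ν F (i , zero)
    combination-stretchSet-wing a = ℚΣ.∑ᴸ-cong (λ m → cong (λ x → ν m ℚ.* indicator x) (stretchSet-≡ i (F m) (suc a)))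

    combination-stretchSet-hub : combination ν (λ m → stretchSet i (F m)) (i , zero) ℚ.+ combination ν F (i , zero)
                                 ≡ ℚΣ.∑ᴸ ν
    combination-stretchSet-hub = trans (sym (ℚΣ.∑ᴸ-distrib-+ new old)) (ℚΣ.∑ᴸ-cong complement)
      where
      new old : Lab n → ℚ
      new m = ν m ℚ.* indicator (stretchSet i (F m) (i , zero))
      old m = ν m ℚ.* indicator (F m (i , zero))
      complement : ∀ m → new m ℚ.+ old m ≡ ν m
      complement m rewrite stretchSet-≡ i (F m) zero with F m (i , zero)
      ... | true  = solve 1 (λ x → x :* con 0ℚ :+ x :* con 1ℚ := x) refl (ν m)
      ... | false = solve 1 (λ x → x :* con 1ℚ :+ x :* con 0ℚ := x) refl (ν m)

  module StretchStep {D adj} (B : Built n D adj) (i : Fin n) (Di : D i ≡ false) (A₁ A₂ : Lab n → Bool)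
                     (A₁⊆N : ∀ u → A₁ u ≡ true → adj (i , zero) u ≡ true)
                     (A₂⊆N : ∀ u → A₂ u ≡ true → adj (i , zero) u ≡ true)
                     (cover : ∀ u → adj (i , zero) u ≡ true → A₁ u ≡ true ⊎ A₂ u ≡ true)
                     (w : WingsAvoid B) (avoid : ∀ a → Avoids (newAdj (suc a) A₁ A₂) i) where

    private
      F F′ : Lab n → Lab n → Bool
      F  = family B w
      F′ = family (stretch B i Di A₁ A₂ A₁⊆N A₂⊆N cover) (w , avoid)

      W : Fin 2 → Lab n → Bool
      W a = wingSet D i (proj₁ (avoid a)) a

      F′-wing : ∀ a c → F′ (i , suc a) c ≡ W a c
      F′-wing a c with i ≟ i
      ... | yes _  = refl
      ... | no i≢i = ⊥-elim (i≢i refl)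

      W-at : ∀ a b → W a (i , b) ≡ onlyWing a b
      W-at a = [≔]-≡ {f = hubsTop D (proj₁ (avoid a))} {i = i} {g = onlyWing a}

      wingTerms : (Lab n → ℚ) → Lab n → ℚ
      wingTerms μ c =
        μ (i , suc zero) ℚ.* indicator (W zero c) ℚ.+ μ (i , suc (suc zero)) ℚ.* indicator (W (suc zero) c)

      combination-split : ∀ μ c → combination μ F′ c ≡
                          combination (dropWings i μ) (λ m → stretchSet i (F m)) c ℚ.+ wingTerms μ c
      combination-split μ c = begin
        combination μ F′ c
          ≡⟨ ∑ᴸ-dropWings i (λ m → μ m ℚ.* indicator (F′ m c)) ⟩
        ℚΣ.∑ᴸ (dropWings i (λ m → μ m ℚ.* indicator (F′ m c))) ℚ.+
          (μ (i , suc zero) ℚ.* indicator (F′ (i , suc zero) c) ℚ.+ μ (i , suc (suc zero)) ℚ.* indicator (F′ (i , suc (suc zero)) c))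
          ≡⟨ cong₂ ℚ._+_ (ℚΣ.∑ᴸ-cong term)
               (cong₂ ℚ._+_ (cong (λ x → μ (i , suc zero) ℚ.* indicator x) (F′-wing zero c))
                            (cong (λ x → μ (i , suc (suc zero)) ℚ.* indicator x) (F′-wing (suc zero) c))) ⟩
        combination (dropWings i μ) (λ m → stretchSet i (F m)) c ℚ.+ wingTerms μ c ∎
        where
        open ≡-Reasoning
        term : ∀ m → dropWings i (λ m → μ m ℚ.* indicator (F′ m c)) m
                     ≡ dropWings i μ m ℚ.* indicator (stretchSet i (F m) c)
        term (k , zero) with k ≟ i
        ... | yes refl = refl
        ... | no _     = refl
        term (k , suc a) with k ≟ i
        ... | yes refl = sym (ℚ.*-zeroˡ (indicator (stretchSet i (F (k , suc a)) c)))
        ... | no _     = refl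

    -- Evaluating the dependence at (i , 0), (i , 1), (i , 2) and summing it gives
    -- σ₀ = A, A + l₁ = 0, A + l₂ = 0 and σ₀ + l₁ + l₂ = 0, so all four vanish.
    module Coefficients (μ : Lab n → ℚ) (sum≡0 : ℚΣ.∑ᴸ μ ≡ 0ℚ)
                        (comb≡0 : ∀ c → valid (insertD D i) c ≡ true → combination μ F′ c ≡ 0ℚ) where

      μ₀ : Lab n → ℚ
      μ₀ = dropWings i μ
      l₁ l₂ A σ₀ : ℚ
      l₁ = μ (i , suc zero)
      l₂ = μ (i , suc (suc zero))
      A  = combination μ₀ F (i , zero)
      σ₀ = ℚΣ.∑ᴸ μ₀

      A+l≡0 : ∀ a → A ℚ.+ μ (i , suc a) ≡ 0ℚ
      A+l≡0 a = begin
        A ℚ.+ μ (i , suc a)                               ≡⟨ cong₂ ℚ._+_ (combination-stretchSet-wing μ₀ F i a) (wings a) ⟨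
        combination μ₀ (λ m → stretchSet i (F m)) (i , suc a) ℚ.+ wingTerms μ (i , suc a)
                                                          ≡⟨ combination-split μ (i , suc a) ⟨
        combination μ F′ (i , suc a)                      ≡⟨ comb≡0 (i , suc a) (insertD-≡ D i) ⟩
        0ℚ                                                ∎
        where
        open ≡-Reasoning
        wings : ∀ a → wingTerms μ (i , suc a) ≡ μ (i , suc a)
        wings zero rewrite W-at zero (suc zero) | W-at (suc zero) (suc zero) =
          trans (cong₂ ℚ._+_ (ℚ.*-identityʳ l₁) (ℚ.*-zeroʳ l₂)) (ℚ.+-identityʳ l₁)
        wings (suc zero) rewrite W-at zero (suc (suc zero)) | W-at (suc zero) (suc (suc zero)) =
          trans (cong₂ ℚ._+_ (ℚ.*-zeroʳ l₁) (ℚ.*-identityʳ l₂)) (ℚ.+-identityˡ l₂)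

      A≡σ₀ : A ≡ σ₀
      A≡σ₀ = begin
        A                                                            ≡⟨ ℚ.+-identityˡ A ⟨
        0ℚ ℚ.+ A                                                     ≡⟨ cong (ℚ._+ A) stretched-hub≡0 ⟨
        combination μ₀ (λ m → stretchSet i (F m)) (i , zero) ℚ.+ A   ≡⟨ combination-stretchSet-hub μ₀ F i ⟩
        σ₀                                                           ∎
        where
        open ≡-Reasoning
        wings : wingTerms μ (i , zero) ≡ 0ℚ
        wings rewrite W-at zero zero | W-at (suc zero) zero =
          trans (cong₂ ℚ._+_ (ℚ.*-zeroʳ l₁) (ℚ.*-zeroʳ l₂)) (ℚ.+-identityʳ 0ℚ)
        stretched-hub≡0 : combination μ₀ (λ m → stretchSet i (F m)) (i , zero) ≡ 0ℚ
        stretched-hub≡0 =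
          trans (sym (+-vanishʳ wings)) (trans (sym (combination-split μ (i , zero))) (comb≡0 (i , zero) refl))

      A≡0 : A ≡ 0ℚ
      A≡0 = linear-system (A+l≡0 zero) (A+l≡0 (suc zero))
              (trans (cong (ℚ._+ (l₁ ℚ.+ l₂)) A≡σ₀) (trans (sym (∑ᴸ-dropWings i μ)) sum≡0))

      l≡0 : ∀ a → μ (i , suc a) ≡ 0ℚ
      l≡0 a = trans (sym (ℚ.+-identityˡ _)) (trans (cong (ℚ._+ μ (i , suc a)) (sym A≡0)) (A+l≡0 a))

      wingTerms≡0 : ∀ c → wingTerms μ c ≡ 0ℚ
      wingTerms≡0 c = trans (cong₂ ℚ._+_ (vanish zero) (vanish (suc zero))) (ℚ.+-identityʳ 0ℚ)
        where
        vanish : ∀ a → μ (i , suc a) ℚ.* indicator (W a c) ≡ 0ℚ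
        vanish a = trans (cong (ℚ._* indicator (W a c)) (l≡0 a)) (ℚ.*-zeroˡ (indicator (W a c)))

      old-comb≡0 : ∀ c → valid D c ≡ true → combination μ₀ F c ≡ 0ℚ
      old-comb≡0 (k , b) v with k ≟ i
      old-comb≡0 (k , zero)  v | yes refl = A≡0
      old-comb≡0 (k , suc b) v | yes refl = ⊥-elim (true≢false (trans (sym v) Di))
      old-comb≡0 (k , b)     v | no k≢i   = begin
        combination μ₀ F (k , b)                                     ≡⟨ combination-stretchSet-≢ μ₀ F i b k≢i ⟨
        combination μ₀ (λ m → stretchSet i (F m)) (k , b)            ≡⟨ +-vanishʳ (wingTerms≡0 (k , b)) ⟨
        combination μ₀ (λ m → stretchSet i (F m)) (k , b) ℚ.+ wingTerms μ (k , b)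
                                                                     ≡⟨ combination-split μ (k , b) ⟨
        combination μ F′ (k , b)                                     ≡⟨ comb≡0 (k , b) (valid-insertD D i (k , b) v) ⟩
        0ℚ                                                           ∎
        where open ≡-Reasoning

    independent : AffinelyIndependentᴸ D F → AffinelyIndependentᴸ (insertD D i) F′
    independent IH μ invalid sum≡0 comb≡0 = μ≡0
      where
      open Coefficients μ sum≡0 comb≡0

      old-invalid : ∀ l → valid D l ≡ false → μ₀ l ≡ 0ℚ
      old-invalid (k , suc b) v with k ≟ i
      ... | yes refl = refl
      ... | no k≢i   = invalid (k , suc b) (trans (insertD-≢ D k≢i) v)

      μ₀≡0 : ∀ l → μ₀ l ≡ 0ℚ
      μ₀≡0 = IH μ₀ old-invalid (trans (sym A≡σ₀) A≡0) old-comb≡0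

      μ≡0 : ∀ l → μ l ≡ 0ℚ
      μ≡0 (k , b) with k ≟ i
      ... | no k≢i = trans (sym ([≔]-≢ {f = μ} {g = hubPart (μ (i , zero))} b k≢i)) (μ₀≡0 (k , b))
      μ≡0 (k , zero)           | yes refl =
        trans (sym ([≔]-≡ {f = μ} {i = i} {g = hubPart (μ (i , zero))} zero)) (μ₀≡0 (i , zero))
      μ≡0 (k , suc zero)       | yes refl = l≡0 zero
      μ≡0 (k , suc (suc zero)) | yes refl = l≡0 (suc zero)

  family-independent : ∀ {D adj} (B : Built n D adj) w → AffinelyIndependentᴸ D (family B w)
  family-independent base w μ invalid _ comb≡0 (j , suc a) = invalid (j , suc a) refl
  family-independent base w μ invalid _ comb≡0 (j , zero) = begin
    μ (j , zero)
      ≡⟨ ℚ.*-identityʳ (μ (j , zero)) ⟨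
    μ (j , zero) ℚ.* 1ℚ
      ≡⟨ cong (λ x → μ (j , zero) ℚ.* indicator x) (dec-true ((j , zero) ≟ᴸ (j , zero)) refl) ⟨
    μ (j , zero) ℚ.* indicator (singleton (j , zero) (j , zero))
                                                  ≡⟨ ℚΣ.∑ᴸ-single (j , zero) others ⟨
    combination μ (family base w) (j , zero)
      ≡⟨ comb≡0 (j , zero) refl ⟩
    0ℚ ∎
    where
    open ≡-Reasoning
    others : ∀ m → m ≢ (j , zero) → μ m ℚ.* indicator (family base w m (j , zero)) ≡ 0ℚ
    others (k , zero) m≢j rewrite dec-false ((j , zero) ≟ᴸ (k , zero)) (λ j≡m → m≢j (sym j≡m)) = ℚ.*-zeroʳ (μ (k , zero))
    others (k , suc a) _ = ℚ.*-zeroʳ (μ (k , suc a))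
  family-independent (stretch B i Di A₁ A₂ A₁⊆N A₂⊆N cover) (w , avoid) =
    StretchStep.independent B i Di A₁ A₂ A₁⊆N A₂⊆N cover w avoid (family-independent B w)

-- Wings avoid a group in every 𝒦̃ graph

module _ {n : ℕ} where

  WingsMissGroups : (Fin n → Bool) → (Lab n → Lab n → Bool) → Set
  WingsMissGroups D adj = ∀ i a → D i ≡ true → ∃[ j ] j ≢ i × (∀ b → adj (i , suc a) (j , b) ≡ false)

  -- Contacts of a wing with other groups survive later stretchings, so the 𝒦̃ condition
  -- of the final graph already holds for each wing when it is created.
  KeepsWingContacts : (Fin n → Bool) → (Lab n → Lab n → Bool) → (Fin n → Bool) → (Lab n → Lab n → Bool) → Set
  KeepsWingContacts D adj D′ adj′ =
    (∀ i → D i ≡ true → D′ i ≡ true) ×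
    (∀ i a j b → j ≢ i → adj (i , suc a) (j , b) ≡ true → ∃[ b′ ] adj′ (i , suc a) (j , b′) ≡ true)

  keeps-refl : ∀ D adj → KeepsWingContacts D adj D adj
  keeps-refl D adj = (λ _ Di → Di) , (λ _ _ _ b _ e → b , e)

  keeps-trans : ∀ {D₁ adj₁ D₂ adj₂ D₃ adj₃} → KeepsWingContacts D₁ adj₁ D₂ adj₂ → KeepsWingContacts D₂ adj₂ D₃ adj₃ →
                KeepsWingContacts D₁ adj₁ D₃ adj₃
  keeps-trans (D₁⊆D₂ , keep₁₂) (D₂⊆D₃ , keep₂₃) =
    (λ i Di → D₂⊆D₃ i (D₁⊆D₂ i Di)) ,
    (λ i a j b j≢i e → let b′ , e′ = keep₁₂ i a j b j≢i e in keep₂₃ i a j b′ j≢i e′)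

  keeps-stretch : ∀ {D adj} → Built n D adj → ∀ i → D i ≡ false → (A₁ A₂ : Lab n → Bool) →
                  (∀ u → adj (i , zero) u ≡ true → A₁ u ≡ true ⊎ A₂ u ≡ true) →
                  KeepsWingContacts D adj (insertD D i) (stretchAdj adj i A₁ A₂)
  keeps-stretch {D} {adj} B i Di A₁ A₂ cover = D⊆D′ , keep
    where
    D⊆D′ : ∀ j → D j ≡ true → insertD D i j ≡ true
    D⊆D′ j Dj with j ≟ i
    ... | yes _ = refl
    ... | no _  = Dj

    keep : ∀ i₀ a j b → j ≢ i₀ → adj (i₀ , suc a) (j , b) ≡ true →
           ∃[ b′ ] stretchAdj adj i A₁ A₂ (i₀ , suc a) (j , b′) ≡ true
    keep i₀ a j b j≢i₀ e with i₀ ≟ i | j ≟ i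
    ... | yes refl | _ = ⊥-elim (true≢false (trans (sym (built-valid B (i₀ , suc a) (j , b) e)) Di))
    ... | no _ | no _ = b , e
    keep i₀ a j (suc b) j≢i₀ e | no _ | yes refl =
      ⊥-elim (true≢false (trans (sym (built-valid B (j , suc b) (i₀ , suc a) (trans (built-sym B _ _) e))) Di))
    keep i₀ a j zero j≢i₀ e | no _ | yes refl with cover (i₀ , suc a) (trans (built-sym B (j , zero) (i₀ , suc a)) e)
    ... | inj₁ A₁w = suc zero , A₁w
    ... | inj₂ A₂w = suc (suc zero) , A₂w

  wingsAvoid : ∀ {D adj D′ adj′} (B : Built n D adj) → KeepsWingContacts D adj D′ adj′ → WingsMissGroups D′ adj′ →
               WingsAvoid B
  wingsAvoid base _ _ = _
  wingsAvoid {D′ = D′} {adj′} (stretch {D = D} {adj} B i Di A₁ A₂ _ _ cover) keeps miss =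
    wingsAvoid {D′ = D′} {adj′} B (keeps-trans {D₁ = D} {adj} {insertD D i} {stretchAdj adj i A₁ A₂} {D′} {adj′}
                              (keeps-stretch B i Di A₁ A₂ cover) keeps) miss , avoid
    where
    avoid : ∀ a → Avoids (newAdj (suc a) A₁ A₂) i
    avoid a with miss i a (proj₁ keeps i (insertD-≡ D i))
    ... | j , j≢i , missed = j , j≢i , λ b → ¬-not λ e →
      let b′ , e′ = proj₂ keeps i a j b j≢i (trans (StretchAdj.stretchAdj-newˡ adj i A₁ A₂ (suc a) b j≢i) e)
      in true≢false (trans (sym e′) (missed b′))


wingsMissGroups : ∀ {V E n d} (G : InK V E n d) → InK.TildeCondition G → WingsMissGroups (InK.D G) (InK.adj G)
wingsMissGroups {E = E} G tilde i a Di with InK.labSurj G (i , suc a) Di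
... | w , lw with tilde w i a lw
... | j , j≢i , missed = j , j≢i , λ b → ¬-not λ e → contact b e
  where
  open InK G
  contact : ∀ b → adj (i , suc a) (j , b) ≡ true → ⊥
  contact b e with labSurj (j , b) (built-valid built (j , b) (i , suc a) (trans (built-sym built (j , b) (i , suc a)) e))
  ... | v , lv = true≢false (begin
    true                   ≡⟨ e ⟨
    adj (i , suc a) (j , b) ≡⟨ cong₂ adj lw lv ⟨
    adj (lab w) (lab v)    ≡⟨ labAdj w v ⟨
    E w v                  ≡⟨ missed v (cong proj₁ lv) ⟩
    false                  ∎)
    where open ≡-Reasoning

record Labelling (N n : ℕ) (D : Fin n → Bool) : Set where
  field
    member           : Fin N → Bool
    label            : Fin N → Lab n
    label-valid      : ∀ {c} → member c ≡ true → valid D (label c) ≡ true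
    label-injective  : ∀ {c c′} → member c ≡ true → member c′ ≡ true → label c ≡ label c′ → c ≡ c′
    label-surjective : ∀ l → valid D l ≡ true → ∃[ c ] member c ≡ true × label c ≡ l

  module _ {A : Set} (f : Fin N → A) (a : A) where

    private
      pullbackAt : ∀ l b → valid D l ≡ b → A
      pullbackAt l true  v = f (proj₁ (label-surjective l v))
      pullbackAt l false _ = a

    pullback : Lab n → A
    pullback l = pullbackAt l (valid D l) refl

    pullback-label : ∀ {c} → member c ≡ true → pullback (label c) ≡ f c
    pullback-label {c} mc = at (valid D (label c)) refl
      where
      at : ∀ b (v : valid D (label c) ≡ b) → pullbackAt (label c) b v ≡ f c
      at true  v = let _ , mc′ , lc′ = label-surjective (label c) v in cong f (label-injective mc′ mc lc′)
      at false v = ⊥-elim (true≢false (trans (sym (label-valid mc)) v))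

    pullback-invalid : ∀ {l} → valid D l ≡ false → pullback l ≡ a
    pullback-invalid {l} invalid = at (valid D l) refl
      where
      at : ∀ b (v : valid D l ≡ b) → pullbackAt l b v ≡ a
      at true  v = ⊥-elim (true≢false (trans (sym v) invalid))
      at false _ = refl

    pullback-valid : ∀ {l} → pullback l ≢ a → valid D l ≡ true
    pullback-valid {l} ≢a = at (valid D l) refl
      where
      at : ∀ b (v : valid D l ≡ b) → valid D l ≡ true
      at true  v = v
      at false v = ⊥-elim (≢a (pullback-invalid {l} v))

    pullback-witness : ∀ {l} → valid D l ≡ true → ∃[ c ] member c ≡ true × label c ≡ l × pullback l ≡ f c
    pullback-witness {l} v = let c , mc , lc = label-surjective l v in
      c , mc , lc , trans (cong pullback (sym lc)) (pullback-label mc)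

module LabelledSum (M : CommutativeMonoid 0ℓ 0ℓ) {N n D} (ℒ : Labelling N n D) where

  open CommutativeMonoid M
    using (Carrier; _≈_; setoid; reflexive)
    renaming (ε to 0#; trans to ≈-trans; sym to ≈-sym; refl to ≈-refl)
  open FinSum M
  open Labelling ℒ

  sum-members : ∀ (F : Lab n → Carrier) → (∀ l → valid D l ≡ false → F l ≈ 0#) →
                sum (λ c → if member c then F (label c) else 0#) ≈ ∑ᴸ F
  sum-members F F≈0 = begin
    sum (λ c → if member c then F (label c) else 0#)  ≈⟨ sum-cong-≋ row ⟨
    sum (λ c → ∑ᴸ (term c))                           ≈⟨ ∑-comm (λ c i → sum (λ b → term c (i , b))) ⟩
    sum (λ i → sum (λ c → sum (λ b → term c (i , b)))) ≈⟨ sum-cong-≋ (λ i → ∑-comm (λ c b → term c (i , b))) ⟩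
    ∑ᴸ (λ l → sum (λ c → term c l))                   ≈⟨ ∑ᴸ-cong column ⟩
    ∑ᴸ F                                              ∎
    where
    open import Relation.Binary.Reasoning.Setoid setoid
    term : Fin N → Lab n → Carrier
    term c l = if member c ∧ does (label c ≟ᴸ l) then F l else 0#

    row : ∀ c → ∑ᴸ (term c) ≈ (if member c then F (label c) else 0#)
    row c with member c
    ... | false = ∑ᴸ-zero {n} (λ _ → ≈-refl)
    ... | true  = ≈-trans (∑ᴸ-single (label c) off) (reflexive at)
      where
      off : ∀ l → l ≢ label c → (if does (label c ≟ᴸ l) then F l else 0#) ≈ 0#
      off l l≢c rewrite dec-false (label c ≟ᴸ l) (λ c≡l → l≢c (sym c≡l)) = ≈-refl
      at : (if does (label c ≟ᴸ label c) then F (label c) else 0#) ≡ F (label c)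
      at rewrite dec-true (label c ≟ᴸ label c) refl = refl

    absent : ∀ c l → (member c ≡ true → label c ≢ l) → term c l ≈ 0#
    absent c l none with member c | label c ≟ᴸ l
    ... | false | _       = ≈-refl
    ... | true  | no _    = ≈-refl
    ... | true  | yes c≡l = ⊥-elim (none refl c≡l)

    column : ∀ l → sum (λ c → term c l) ≈ F l
    column l with valid D l in v
    ... | false = ≈-trans (sum-zero (λ c → absent c l (unlabelled c))) (≈-sym (F≈0 l v))
      where
      unlabelled : ∀ c → member c ≡ true → label c ≢ l
      unlabelled c mc c≡l = true≢false (trans (sym (label-valid mc)) (trans (cong (valid D) c≡l) v))
    ... | true  with label-surjective l v
    ...   | c₀ , mc₀ , lc₀ = ≈-trans (sum-single c₀ others) (reflexive at)
      where
      others : ∀ c → c ≢ c₀ → term c l ≈ 0#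
      others c c≢c₀ = absent c l (λ mc c≡l → c≢c₀ (label-injective mc mc₀ (trans c≡l (sym lc₀))))
      at : term c₀ l ≡ F l
      at rewrite mc₀ | dec-true (label c₀ ≟ᴸ l) lc₀ = refl

module _ {N n D} (ℒ : Labelling N n D) where

  open Labelling ℒ

  countTrue-members : ∀ S → OnValid D S → countTrue (λ c → member c ∧ S (label c)) ≡ size S
  countTrue-members S onValid = begin
    countTrue (λ c → member c ∧ S (label c))
      ≡⟨ countTrue≡sum (λ c → member c ∧ S (label c)) ⟩
    ℕΣ.sum (λ c → bit (member c ∧ S (label c)))
      ≡⟨ ℕΣ.sum-cong-≋ (λ c → bit-∧ (member c) (S (label c))) ⟩
    ℕΣ.sum (λ c → if member c then bit (S (label c)) else 0)
      ≡⟨ LabelledSum.sum-members ℕ.+-0-commutativeMonoid ℒ (bit ∘′ S) outside ⟩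
    size S ∎
    where
    open ≡-Reasoning
    bit-∧ : ∀ a b → bit (a ∧ b) ≡ (if a then bit b else 0)
    bit-∧ true  b = refl
    bit-∧ false b = refl
    outside : ∀ l → valid D l ≡ false → bit (S l) ≡ 0
    outside l v = cong bit (¬-not λ Sl → true≢false (trans (sym (onValid l Sl)) v))

module Facet {n d N : ℕ} (2≤n : 2 ≤ n) (E : Fin N → Fin N → Bool) (G : InK (Fin N) E n d)
             (k : ℕ) (part : Fin N → Fin (suc k)) (dec : SCDecomposition G k part) where

  open SCDecomposition dec
  module G = InK G

  H : InK (Σ (Fin N) λ v → part v ≡ zero) (λ u w → E (proj₁ u) (proj₁ w)) n (d ∸ k)
  H = InKTilde.struct C₀-tilde
  module H = InK H

  inC₀ : Fin N → Bool
  inC₀ c = does (part c ≟ zero)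

  inC₀⇒part : ∀ {c} → inC₀ c ≡ true → part c ≡ zero
  inC₀⇒part {c} e with part c ≟ zero
  ... | yes p = p

  -- Off C₀ the label is a junk value: H has no such vertex.
  labelC₀ : Fin N → Lab n
  labelC₀ c = labelled (part c ≟ zero)
    where
    labelled : Dec (part c ≡ zero) → Lab n
    labelled (yes p) = H.lab (c , p)
    labelled (no _)  = G.lab c

  labelC₀-≡ : ∀ {c} (p : part c ≡ zero) → labelC₀ c ≡ H.lab (c , p)
  labelC₀-≡ {c} p with part c ≟ zero
  ... | yes p′ = cong (λ q → H.lab (c , q)) (UIP.Decidable⇒UIP.≡-irrelevant _≟_ p′ p)
  ... | no ¬p  = ⊥-elim (¬p p)

  C₀ : Labelling N n H.D
  C₀ = record
    { member           = inC₀
    ; label            = labelC₀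
    ; label-valid      = λ mc → trans (cong (valid H.D) (labelC₀-≡ (inC₀⇒part mc))) (H.labValid _)
    ; label-injective  = λ mc mc′ eq → cong proj₁ (H.labInj _ _
                           (trans (sym (labelC₀-≡ (inC₀⇒part mc))) (trans eq (labelC₀-≡ (inC₀⇒part mc′)))))
    ; label-surjective = λ l v → let (c , p) , lc = H.labSurj l v in
                           c , dec-true (part c ≟ zero) p , trans (labelC₀-≡ p) lc
    }

  C₀-adj : ∀ {c c′} → inC₀ c ≡ true → inC₀ c′ ≡ true → E c c′ ≡ H.adj (labelC₀ c) (labelC₀ c′)
  C₀-adj mc mc′ = trans (H.labAdj _ _) (sym (cong₂ H.adj (labelC₀-≡ (inC₀⇒part mc)) (labelC₀-≡ (inC₀⇒part mc′))))

  Gℒ : Labelling N n G.D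
  Gℒ = record
    { member           = λ _ → true
    ; label            = G.lab
    ; label-valid      = λ _ → G.labValid _
    ; label-injective  = λ _ _ → G.labInj _ _
    ; label-surjective = λ l v → let c , lc = G.labSurj l v in c , refl , lc
    }

  module _ (S : Lab n → Bool) (edge : ∀ {i} → G.D i ≡ true → ∀ ℓ → bit (S (i , zero)) ℕ.+ bit (S (i , suc ℓ)) ≡ 1) where

    private
      f : Fin N → ℕ
      f c = bit (S (G.lab c))

      onPart : Fin (suc k) → Fin N → ℕ
      onPart p c = if does (part c ≟ p) then f c else 0

      edge-sum : ∀ j → ℕΣ.sum (onPart (suc j)) ≡ 1
      edge-sum j with C-edge j
      ... | u , w , pu , pw , only , euw , (i , Di , lu) , (i′ , ℓ , lw) = begin
        ℕΣ.sum (onPart (suc j))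
          ≡⟨ ℕΣ.sum-pair u w u≢w outside ⟩
        onPart (suc j) u ℕ.+ onPart (suc j) w
          ≡⟨ cong₂ ℕ._+_ (at pu) (at pw) ⟩
        f u ℕ.+ f w
          ≡⟨ cong₂ (λ l l′ → bit (S l) ℕ.+ bit (S l′)) lu (trans lw (cong (λ g → g , suc ℓ) i′≡i)) ⟩
        bit (S (i , zero)) ℕ.+ bit (S (i , suc ℓ))
          ≡⟨ edge Di ℓ ⟩
        1 ∎
        where
        open ≡-Reasoning
        i′≡i : i′ ≡ i
        i′≡i = trans (cong proj₁ (sym lw)) (proj₁ (built-hub G.built i (G.lab w) Di
                 (trans (cong (λ l → G.adj l (G.lab w)) (sym lu)) (trans (sym (G.labAdj u w)) euw))))
        u≢w : u ≢ w
        u≢w u≡w with trans (sym lu) (trans (cong G.lab u≡w) lw)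
        ... | ()
        at : ∀ {c} → part c ≡ suc j → onPart (suc j) c ≡ f c
        at {c} pc rewrite dec-true (part c ≟ suc j) pc = refl
        outside : ∀ c → c ≢ u → c ≢ w → onPart (suc j) c ≡ 0
        outside c c≢u c≢w with part c ≟ suc j
        ... | no _   = refl
        ... | yes pc = ⊥-elim ([ c≢u , c≢w ]′ (only c pc))

    countTrue-split : countTrue (λ c → S (G.lab c)) ≡ countTrue (λ c → inC₀ c ∧ S (G.lab c)) ℕ.+ k
    countTrue-split = begin
      countTrue (λ c → S (G.lab c))
        ≡⟨ countTrue≡sum (λ c → S (G.lab c)) ⟩
      ℕΣ.sum f
        ≡⟨ ℕΣ.sum-partition part f ⟩
      ℕΣ.sum (onPart zero) ℕ.+ ℕΣ.sum (λ j → ℕΣ.sum (onPart (suc j)))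
        ≡⟨ cong₂ ℕ._+_ (ℕΣ.sum-cong-≋ first) (trans (ℕΣ.sum-cong-≋ edge-sum) (sum-ones k)) ⟩
      ℕΣ.sum (λ c → bit (inC₀ c ∧ S (G.lab c))) ℕ.+ k
        ≡⟨ cong (ℕ._+ k) (countTrue≡sum (λ c → inC₀ c ∧ S (G.lab c))) ⟨
      countTrue (λ c → inC₀ c ∧ S (G.lab c)) ℕ.+ k ∎
      where
      open ≡-Reasoning
      first : ∀ c → onPart zero c ≡ bit (inC₀ c ∧ S (G.lab c))
      first c with inC₀ c
      ... | true  = refl
      ... | false = refl

  k≤d : k ≤ d
  k≤d = subst (k ≤_) d≡ (ℕ.m≤n+m k _)
    where
    open ≡-Reasoning
    d≡ : countTrue (λ c → inC₀ c ∧ hubs G.D (G.lab c)) ℕ.+ k ≡ d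
    d≡ = begin
      countTrue (λ c → inC₀ c ∧ hubs G.D (G.lab c)) ℕ.+ k  ≡⟨ countTrue-split (hubs G.D) (hubs-edge G.D) ⟨
      countTrue (λ c → hubs G.D (G.lab c))                 ≡⟨ countTrue-members Gℒ (hubs G.D) (hubs-onValid G.D) ⟩
      size (hubs G.D)                                     ≡⟨ size-hubs G.D ⟩
      countTrue G.D                                       ≡⟨ G.countD ⟩
      d                                                   ∎

  countTrue-C₀-hubsTop : ∀ h → countTrue (λ c → inC₀ c ∧ hubsTop G.D h (G.lab c)) ≡ suc (d ∸ k)
  countTrue-C₀-hubsTop h = begin
    countTrue (λ c → inC₀ c ∧ hubsTop G.D h (G.lab c))
      ≡⟨ ℕ.m+n∸n≡m _ k ⟨
    countTrue (λ c → inC₀ c ∧ hubsTop G.D h (G.lab c)) ℕ.+ k ∸ k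
      ≡⟨ cong (_∸ k) (countTrue-split (hubsTop G.D h) (hubsTop-edge G.D h)) ⟨
    countTrue (λ c → hubsTop G.D h (G.lab c)) ∸ k
      ≡⟨ cong (_∸ k) (countTrue-members Gℒ (hubsTop G.D h) (hubsTop-onValid G.D h)) ⟩
    size (hubsTop G.D h) ∸ k
      ≡⟨ cong (_∸ k) (trans (size-hubsTop G.D h) (cong suc G.countD)) ⟩
    suc d ∸ k
      ≡⟨ ℕ.+-∸-assoc 1 k≤d ⟩
    suc (d ∸ k) ∎
    where open ≡-Reasoning

  wingsAvoidH : WingsAvoid H.built
  wingsAvoidH = wingsAvoid {D′ = H.D} {adj′ = H.adj} H.built (keeps-refl H.D H.adj)
                           (wingsMissGroups H (InKTilde.tilde C₀-tilde))

  familyH : Lab n → Lab n → Bool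
  familyH = family H.built wingsAvoidH

  topOf : Fin N → Fin n
  topOf t = proj₁ (hubsTop-covers 2≤n G.D (G.lab t) (G.labValid t))

  tightSet : Fin N → Fin N → Bool
  tightSet t c = if inC₀ t then inC₀ c ∧ familyH (labelC₀ t) (labelC₀ c)
                 else (inC₀ c ∨ does (c ≟ t)) ∧ hubsTop G.D (topOf t) (G.lab c)

  tightSet-stable : ∀ t → Stable E (tightSet t)
  tightSet-stable t with inC₀ t
  ... | true  = λ u v su sv → let mu , Qu = ∧≡true su ; mv , Qv = ∧≡true sv in
                  trans (C₀-adj mu mv) (family-stable H.built _ (labelC₀ t) (labelC₀ u) (labelC₀ v) Qu Qv)
  ... | false = λ u v su sv → trans (G.labAdj u v)
                  (hubsTop-stable G.built (topOf t) (G.lab u) (G.lab v) (proj₂ (∧≡true su)) (proj₂ (∧≡true sv)))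

  tightSet-count : ∀ t → countTrue (λ c → inC₀ c ∧ tightSet t c) ≡ suc (d ∸ k)
  tightSet-count t with inC₀ t in mt
  ... | true  = begin
    countTrue (λ c → inC₀ c ∧ (inC₀ c ∧ familyH (labelC₀ t) (labelC₀ c)))
      ≡⟨ countTrue-cong (λ c → absorb (inC₀ c) _) ⟩
    countTrue (λ c → inC₀ c ∧ familyH (labelC₀ t) (labelC₀ c))
      ≡⟨ countTrue-members C₀ (familyH (labelC₀ t)) (family-onValid H.built _ (labelC₀ t)) ⟩
    size (familyH (labelC₀ t))
      ≡⟨ size-family H.built _ (labelC₀ t) (Labelling.label-valid C₀ mt) ⟩
    suc (countTrue H.D)
      ≡⟨ cong suc H.countD ⟩
    suc (d ∸ k) ∎
    where
    open ≡-Reasoning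
    absorb : ∀ a b → a ∧ (a ∧ b) ≡ a ∧ b
    absorb true  b = refl
    absorb false b = refl
  ... | false = trans (countTrue-cong (λ c → absorb (inC₀ c) _ _)) (countTrue-C₀-hubsTop (topOf t))
    where
    absorb : ∀ a x b → a ∧ ((a ∨ x) ∧ b) ≡ a ∧ b
    absorb true  x b = refl
    absorb false x b = refl

  dot-C₀ : ∀ s → dot (C₀-coeffs part) (incidence s) ≡ toℚ (countTrue (λ c → inC₀ c ∧ s c))
  dot-C₀ s = trans (sumFin-cong coefficient) (sumFin-incidence (λ c → inC₀ c ∧ s c))
    where
    coefficient : ∀ c → C₀-coeffs part c ℚ.* incidence s c ≡ incidence (λ c → inC₀ c ∧ s c) c
    coefficient c with part c
    ... | zero  = ℚ.*-identityˡ (incidence s c)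
    ... | suc _ = ℚ.*-zeroˡ (incidence s c)

  tight : ∀ t → dot (C₀-coeffs part) (incidence (tightSet t)) ≡ rhs d k
  tight t = trans (dot-C₀ (tightSet t)) (trans (cong toℚ (tightSet-count t)) (sym (rhs≡toℚ k≤d)))

  valid-ineq : ValidForSTAB E (C₀-coeffs part) (rhs d k)
  valid-ineq s stable = begin
    dot (C₀-coeffs part) (incidence s)            ≡⟨ dot-C₀ s ⟩
    toℚ (countTrue (λ c → inC₀ c ∧ s c))          ≡⟨ cong toℚ (countTrue-cong restrict) ⟩
    toℚ (countTrue (λ c → inC₀ c ∧ sᴸ (labelC₀ c))) ≡⟨ cong toℚ (countTrue-members C₀ sᴸ onValid) ⟩
    toℚ (size sᴸ)                                 ≤⟨ toℚ-mono-≤ (size-stable-≤ H.built sᴸ onValid stableᴸ) ⟩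
    toℚ (suc (countTrue H.D))                     ≡⟨ cong (λ m → toℚ (suc m)) H.countD ⟩
    toℚ (suc (d ∸ k))                             ≡⟨ rhs≡toℚ k≤d ⟨
    rhs d k                                       ∎
    where
    open ℚ.≤-Reasoning
    open Labelling C₀ using (pullback; pullback-label; pullback-valid; pullback-witness)
    sᴸ : Lab n → Bool
    sᴸ = pullback s false
    restrict : ∀ c → inC₀ c ∧ s c ≡ inC₀ c ∧ sᴸ (labelC₀ c)
    restrict c with inC₀ c in mc
    ... | true  = sym (pullback-label s false mc)
    ... | false = refl
    onValid : OnValid H.D sᴸ
    onValid l e = pullback-valid s false {l} (λ eq → true≢false (trans (sym e) eq))
    stableᴸ : StableLab H.adj sᴸ
    stableᴸ l l′ e e′ with pullback-witness s false {l} (onValid l e) | pullback-witness s false {l′} (onValid l′ e′)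
    ... | c , mc , lc , sc | c′ , mc′ , lc′ , sc′ =
      trans (cong₂ H.adj (sym lc) (sym lc′))
            (trans (sym (C₀-adj mc mc′)) (stable c c′ (trans (sym sc) e) (trans (sym sc′) e′)))

  tightSet-self : ∀ t → inC₀ t ≡ false → tightSet t t ≡ true
  tightSet-self t mt rewrite mt | dec-true (t ≟ t) refl = proj₂ (hubsTop-covers 2≤n G.D (G.lab t) (G.labValid t))

  tightSet-other : ∀ {t t′} → inC₀ t ≡ false → t′ ≢ t → tightSet t′ t ≡ false
  tightSet-other {t} {t′} mt t′≢t with inC₀ t′
  ... | true  rewrite mt = refl
  ... | false rewrite mt | dec-false (t ≟ t′) (λ t≡t′ → t′≢t (sym t≡t′)) = refl

  module Independence (μ : Fin N → ℚ) (sum≡0 : sumFin μ ≡ 0ℚ)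
                      (comb≡0 : ∀ v → sumFin (λ t → μ t ℚ.* incidence (tightSet t) v) ≡ 0ℚ) where

    open Labelling C₀ using (pullback; pullback-label; pullback-invalid; label-surjective)
    open LabelledSum ℚ.+-0-commutativeMonoid C₀ using (sum-members)

    outside : ∀ t → inC₀ t ≡ false → μ t ≡ 0ℚ
    outside t mt = begin
      μ t                                               ≡⟨ ℚ.*-identityʳ (μ t) ⟨
      μ t ℚ.* 1ℚ                                        ≡⟨ cong (λ b → μ t ℚ.* indicator b) (tightSet-self t mt) ⟨
      μ t ℚ.* incidence (tightSet t) t                  ≡⟨ ℚΣ.sum-single t others ⟨
      ℚΣ.sum (λ t′ → μ t′ ℚ.* incidence (tightSet t′) t) ≡⟨ sumFin≡sum (λ t′ → μ t′ ℚ.* incidence (tightSet t′) t) ⟨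
      sumFin (λ t′ → μ t′ ℚ.* incidence (tightSet t′) t) ≡⟨ comb≡0 t ⟩
      0ℚ                                                ∎
      where
      open ≡-Reasoning
      others : ∀ t′ → t′ ≢ t → μ t′ ℚ.* incidence (tightSet t′) t ≡ 0ℚ
      others t′ t′≢t = trans (cong (λ b → μ t′ ℚ.* indicator b) (tightSet-other mt t′≢t)) (ℚ.*-zeroʳ (μ t′))

    ν : Lab n → ℚ
    ν = pullback μ 0ℚ

    ν-invalid : ∀ l → valid H.D l ≡ false → ν l ≡ 0ℚ
    ν-invalid l = pullback-invalid μ 0ℚ {l}

    μ-via-ν : ∀ c → (if inC₀ c then ν (labelC₀ c) else 0ℚ) ≡ μ c
    μ-via-ν c with inC₀ c in mc
    ... | true  = pullback-label μ 0ℚ mc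
    ... | false = sym (outside c mc)

    ∑ν≡0 : ℚΣ.∑ᴸ ν ≡ 0ℚ
    ∑ν≡0 = begin
      ℚΣ.∑ᴸ ν                                              ≡⟨ sum-members ν ν-invalid ⟨
      ℚΣ.sum (λ c → if inC₀ c then ν (labelC₀ c) else 0ℚ)  ≡⟨ ℚΣ.sum-cong-≋ μ-via-ν ⟩
      ℚΣ.sum μ                                             ≡⟨ sumFin≡sum μ ⟨
      sumFin μ                                             ≡⟨ sum≡0 ⟩
      0ℚ                                                   ∎
      where open ≡-Reasoning

    combination≡0 : ∀ l → valid H.D l ≡ true → combination ν familyH l ≡ 0ℚ
    combination≡0 l v with label-surjective l v
    ... | x , mx , refl = begin
      combination ν familyH (labelC₀ x)                          ≡⟨ sum-members F F-invalid ⟨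
      ℚΣ.sum (λ c → if inC₀ c then F (labelC₀ c) else 0ℚ)  ≡⟨ ℚΣ.sum-cong-≋ term ⟩
      ℚΣ.sum (λ c → μ c ℚ.* incidence (tightSet c) x)      ≡⟨ sumFin≡sum (λ c → μ c ℚ.* incidence (tightSet c) x) ⟨
      sumFin (λ c → μ c ℚ.* incidence (tightSet c) x)      ≡⟨ comb≡0 x ⟩
      0ℚ                                                   ∎
      where
      open ≡-Reasoning
      F : Lab n → ℚ
      F m = ν m ℚ.* indicator (familyH m (labelC₀ x))
      F-invalid : ∀ m → valid H.D m ≡ false → F m ≡ 0ℚ
      F-invalid m v = trans (cong (ℚ._* indicator (familyH m (labelC₀ x))) (ν-invalid m v))
                            (ℚ.*-zeroˡ (indicator (familyH m (labelC₀ x))))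
      term : ∀ c → (if inC₀ c then F (labelC₀ c) else 0ℚ) ≡ μ c ℚ.* incidence (tightSet c) x
      term c with inC₀ c in mc
      ... | true  rewrite mx = cong (λ y → y ℚ.* indicator (familyH (labelC₀ c) (labelC₀ x))) (pullback-label μ 0ℚ mc)
      ... | false = sym (trans (cong (ℚ._* indicator rest) (outside c mc)) (ℚ.*-zeroˡ (indicator rest)))
        where
        rest : Bool
        rest = (inC₀ x ∨ does (x ≟ c)) ∧ hubsTop G.D (topOf c) (G.lab x)

    ν≡0 : ∀ l → ν l ≡ 0ℚ
    ν≡0 = family-independent H.built wingsAvoidH ν ν-invalid ∑ν≡0 combination≡0

    μ≡0 : ∀ t → μ t ≡ 0ℚ
    μ≡0 t with inC₀ t in mt
    ... | true  = trans (sym (pullback-label μ 0ℚ mt)) (ν≡0 (labelC₀ t))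
    ... | false = outside t mt

  independent : AffinelyIndependent (λ t → incidence (tightSet t))
  independent μ sum≡0 comb≡0 = Independence.μ≡0 μ sum≡0 comb≡0

  facet : FacetInducing E (C₀-coeffs part) (rhs d k)
  facet = valid-ineq , tightSet , tightSet-stable , tight , independent

lemma2p8 : (n d N : ℕ) → 3 ≤ n →
    (E : Fin N → Fin N → Bool) → (G : InK (Fin N) E n d) →
    (k : ℕ) → (part : Fin N → Fin (Data.Nat.suc k)) → SCDecomposition G k part →
    FacetInducing E (C₀-coeffs part) (rhs d k)
lemma2p8 n d N 3≤n E G k part dec = Facet.facet (ℕ.<⇒≤ 3≤n) E G k part dec
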